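{- Let $k\ge s\ge 3$ and $n\ge k+1$ be integers. Let $G$ be a $2$-connected graph on $n$ vertices with $N_s(G)=g_s(n,k)$, and let $u$ be a vertex of $G$ with two distinct neighbours $v,x$ such that $c_{uv}(G)\le k$ and $N_G(u)\cap N_G(x)\neq\emptyset$. Suppose $N_s(G[x\rightarrow u])=N_s(G)$ and $M(G[x\rightarrow u],uv)=X_{n,k}$. Then $\{u,v\}$ is a $2$-vertex cut of $G$.
   Context: All graphs are finite and simple; equality of graphs means isomorphism. $N_s(G)$ is the number of $s$-cliques of $G$; $N_G(w)$ is the neighbourhood and $N_G[w]=N_G(w)\cup\{w\}$. For an edge $e$, $c_e(G)$ is the maximum length of a cycle of $G$ containing $e$. For an edge $xu$ of $G$, the edge-switching graph $G[x\rightarrow u]$ is obtained from $G$ by replacing each edge $xw$ by the edge $uw$ for every $w\in N_G(x)\setminus N_G[u]$. For integers $m,k$, let $\beta=\lfloor (m-2)/(k-2)\rfloor$, $q=m-2-\beta(k-2)$ and $X_{m,k}=K_2\vee(\beta K_{k-2}+K_q)$ (join of $K_2$ with the disjoint union of $\beta$ copies of $K_{k-2}$ and one $K_q$); $g_s(m,k)$ is the number of $s$-cliques of $X_{m,k}$, i.e. $\beta\binom{k}{s}+\binom{q+2}{s}$ for $s\ge3$. For a graph $H$ with an edge $uv$ and $c_{uv}(H)\le k$, $M(H,uv)$ denotes an edge-maximal graph with respect to $H$ and $uv$: a graph on $V(H)$ containing $H$ as a spanning subgraph with $c_{uv}(M(H,uv))\le k$ and $c_{uv}(M(H,uv)+f)>k$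 for every non-edge $f$ of $M(H,uv)$. -}

module Defs where

open import Data.Nat using (ℕ; zero; suc; _∸_; _<_; _≤_; _≡ᵇ_)
open import Data.Nat.DivMod using (_/_)
open import Data.Bool using (Bool; true; false; _∧_; _∨_; not; if_then_else_; T)
open import Data.Fin using (Fin; toℕ; _≟_)
open import Data.Fin.Subset using (Subset; ∣_∣)
open import Data.Vec using (Vec; []; _∷_; lookup)
open import Data.List using (List; []; _∷_; _++_; map; length; filterᵇ; allFin; foldr)
open import Data.List.Relation.Unary.Unique.Propositional using (Unique)
open import Data.List.Relation.Unary.Linked using (Linked)
open import Data.Product using (Σ; ∃; _×_)
open import Data.Sum using (_⊎_)
open import Data.Empty using (⊥)
open import Relation.Nullary using (¬_; does)
open import Relation.Binary.PropositionalEquality using (_≡_; _≢_)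
open import Function.Bundles using (_↔_; Inverse)

-- A graph is presented by a Boolean matrix; its edge relation is the
-- symmetric, irreflexive closure (so every matrix denotes a simple graph
-- and every simple graph arises this way).

Graph : ℕ → Set
Graph n = Fin n → Fin n → Bool

module _ {n : ℕ} where

  _==_ : Fin n → Fin n → Bool
  a == b = does (a ≟ b)

  edge : Graph n → Fin n → Fin n → Bool
  edge G a b = not (a == b) ∧ (G a b ∨ G b a)

  Adj : Graph n → Fin n → Fin n → Set
  Adj G a b = T (edge G a b)

  _⊆G_ : Graph n → Graph n → Set
  H ⊆G M = ∀ a b → Adj H a b → Adj M a b

  -- isomorphism ("equality of graphs")
  _≅_ : Graph n → Graph n → Set
  G ≅ H = Σ (Fin n ↔ Fin n) λ f →
            ∀ a b → (Adj G a b → Adj H (Inverse.to f a) (Inverse.to f b))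
                  × (Adj H (Inverse.to f a) (Inverse.to f b) → Adj G a b)

  addEdge : Graph n → Fin n → Fin n → Graph n
  addEdge G a b i j = edge G i j ∨ ((i == a) ∧ (j == b))

  -- edge switching G[x → u]: every edge xw with w ∈ N(x) \ N[u]
  -- is replaced by uw.
  switch : Graph n → Fin n → Fin n → Graph n
  switch G x u a b =
    if a == x then edge G x b ∧ ((b == u) ∨ edge G u b)
    else if a == u then edge G u b ∨ (edge G x b ∧ not (b == u))
    else if (b == x) ∨ (b == u) then false
    else edge G a b

  allSubsets : (m : ℕ) → List (Subset m)
  allSubsets zero = [] ∷ []
  allSubsets (suc m) = map (true ∷_) (allSubsets m) ++ map (false ∷_) (allSubsets m)

  allB : {A : Set} → (A → Bool) → List A → Bool
  allB p = foldr (λ a r → p a ∧ r) true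

  isClique : Graph n → Subset n → Bool
  isClique G S =
    allB (λ i → allB (λ j → not (lookup S i ∧ lookup S j ∧ not (i == j)) ∨ edge G i j)
                   (allFin n))
        (allFin n)

  N : ℕ → Graph n → ℕ
  N s G = length (filterᵇ (λ S → (∣ S ∣ ≡ᵇ s) ∧ isClique G S) (allSubsets n))

  CycleThrough : Graph n → Fin n → Fin n → ℕ → Set
  CycleThrough G u v L = ∃ λ (mid : List (Fin n)) →
      Unique (u ∷ mid ++ v ∷ [])
    × Linked (Adj G) (u ∷ mid ++ v ∷ [])
    × length (u ∷ mid ++ v ∷ []) ≡ L
    × 3 ≤ L
    × Adj G u v

  cLe : Graph n → Fin n → Fin n → ℕ → Set
  cLe G u v k = ∀ L → CycleThrough G u v L → L ≤ k

  cGt : Graph n → Fin n → Fin n → ℕ → Set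
  cGt G u v k = ∃ λ L → k < L × CycleThrough G u v L

  EdgeMaximal : ℕ → Graph n → Fin n → Fin n → Graph n → Set
  EdgeMaximal k H u v M =
      H ⊆G M
    × cLe M u v k
    × (∀ a b → a ≢ b → ¬ Adj M a b → cGt (addEdge M a b) u v k)

  data Walk (G : Graph n) (D : Fin n → Set) : Fin n → Fin n → Set where
    here : ∀ {a} → Walk G D a a
    step : ∀ {a b c} → Adj G a b → ¬ D b → Walk G D b c → Walk G D a c

  ConnectedMinus : Graph n → (Fin n → Set) → Set
  ConnectedMinus G D = ∀ a b → ¬ D a → ¬ D b → Walk G D a b

  TwoConnected : Graph n → Set
  TwoConnected G = 3 ≤ n
                 × ConnectedMinus G (λ _ → ⊥)
                 × (∀ w → ConnectedMinus G (λ z → z ≡ w))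

  IsVertexCut2 : Graph n → Fin n → Fin n → Set
  IsVertexCut2 G u v = ¬ ConnectedMinus G (λ z → z ≡ u ⊎ z ≡ v)

-- X_{m,k} = K₂ ∨ (β K_{k-2} + K_q): vertices 0,1 form the K₂; vertex i ≥ 2
-- lies in block ⌊(i-2)/(k-2)⌋ (blocks 0..β-1 of size k-2, block β of size q).

blockOf : ℕ → ℕ → ℕ
blockOf zero j = j          -- irrelevant case k ≤ 2
blockOf (suc d) j = j / suc d

X : (m k : ℕ) → Graph m
X m k i j =
  if (toℕ i Data.Nat.<ᵇ 2) ∨ (toℕ j Data.Nat.<ᵇ 2) then true
  else blockOf (k ∸ 2) (toℕ i ∸ 2) ≡ᵇ blockOf (k ∸ 2) (toℕ j ∸ 2)

g : ℕ → ℕ → ℕ → ℕ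
g s m k = N s (X m k)

-- Write G' = G[x → u] and k = 3 + d, so that a block of X n k has K = k − 2 vertices.
-- Since G' ⊆ M ≅ X n k and both have g_s(n,k) s-cliques, every s-clique of M is one of G';
-- hence the two hubs of X (its K₂) together with any full block, a k-clique of M, span a
-- clique of G'.
-- Every edge of X n k leaving the hubs lies on a cycle of length k + 1, so c_uv(M) ≤ k forces
-- u and v to be the hubs of M. If G − {u,v} were connected, some edge of G would join two
-- blocks of M; it is not an edge of G' ⊆ M, so it is an edge xw removed by the switch. Of the
-- two distinct blocks of w and x the lower one is full. If it is the block of w, then
-- u x w (block of w) v is a cycle of length k + 1 through uv in G. If it is the block of x,
-- 2-connectivity gives a path from w to {u,v} avoiding x, which stays outside the block of x
-- and closes, through x and its block, a cycle of length at least k + 1 through uv.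
-- Both contradict c_uv(G) ≤ k.

module Submission where

open import Defs
open import Data.Nat using (ℕ; zero; suc; _+_; _*_; _∸_; _<_; _≤_; z≤n; s≤s; _≡ᵇ_; _<ᵇ_)
open import Data.Nat.DivMod using (_/_; _%_)
import Data.Nat.DivMod as DivMod
import Data.Nat.Divisibility as Div
import Data.Nat.Properties as ℕ
open import Data.Fin as Fin using (Fin; toℕ; _≟_)
import Data.Fin.Properties as Fin
open import Data.Fin.Subset using (Subset; ∣_∣)
open import Data.Vec as Vec using (lookup)
import Data.Vec.Properties as Vec
open import Data.Bool using (Bool; true; false; T; _∧_; _∨_; not)
open import Data.Bool.Properties using (T?; T-∨; T-∧)
open import Data.List using (List; tabulate; []; _∷_; _++_; length; filter; filterᵇ; map; reverse; allFin; take; applyUpTo)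
import Data.List.Properties as List
open import Data.List.Relation.Unary.All as All using (All; []; _∷_)
import Data.List.Relation.Unary.All.Properties as All
open import Data.List.Relation.Unary.Any using (here; there)
open import Data.List.Membership.Propositional using (_∈_; _∉_)
open import Data.List.Membership.Propositional.Properties
open import Data.List.Membership.Propositional.Properties.WithK using (unique∧set⇒bag)
open import Data.List.Relation.Binary.BagAndSetEquality using (∼bag⇒↭)
open import Data.List.Relation.Binary.Permutation.Propositional using (_↭_)
import Data.List.Relation.Binary.Permutation.Propositional.Properties as Perm
open import Data.List.Relation.Unary.Unique.Propositional using (Unique; []; _∷_)
import Data.List.Relation.Unary.Unique.Propositional.Properties as Unique
import Data.List.Relation.Unary.AllPairs as AllPairs
open import Data.List.Relation.Unary.Linked as Linked using (Linked; []; [-]; _∷_)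
import Data.List.Relation.Unary.Linked.Properties as Linked
open import Data.Unit using (tt)
open import Data.Product using (∃; _×_; _,_; proj₁; proj₂)
open import Data.Sum as Sum using (_⊎_; inj₁; inj₂; swap; [_,_])
open import Data.Empty using (⊥; ⊥-elim)
open import Function using (_∘_; _$_; case_of_)
open import Function.Bundles using (Inverse; Equivalence; _⇔_; mk⇔)
open import Relation.Nullary using (¬_; Dec; yes; no; does; ¬?)
open import Relation.Nullary.Decidable using (decidable-stable; _⊎-dec_)
open import Relation.Binary.Definitions using (DecidableEquality; tri<; tri≈; tri>)
import Relation.Unary as U
open import Relation.Binary.PropositionalEquality using (_≡_; _≢_; refl; sym; trans; cong; cong₂; subst; subst₂)
open Relation.Binary.PropositionalEquality.≡-Reasoning

-- Lists and counting

T-does⁻ : ∀ {P : Set} (P? : Dec P) → T (does P?) → P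
T-does⁻ (yes p) _ = p

T-does⁺ : ∀ {P : Set} (P? : Dec P) → P → T (does P?)
T-does⁺ (yes _) _ = tt
T-does⁺ (no ¬p) p = ¬p p

T-ext : ∀ {a b} → (T a → T b) → (T b → T a) → a ≡ b
T-ext {true} {true} _ _ = refl
T-ext {true} {false} a⇒b _ = ⊥-elim (a⇒b tt)
T-ext {false} {true} _ b⇒a = ⊥-elim (b⇒a tt)
T-ext {false} {false} _ _ = refl

count : {A : Set} → (A → Bool) → List A → ℕ
count p xs = length (filterᵇ p xs)

module _ {A : Set} where

  Complete : (A → A → Set) → List A → Set
  Complete R xs = ∀ {a b} → a ∈ xs → b ∈ xs → a ≢ b → R a b

  complete⇒linked : ∀ {R : A → A → Set} {xs} → Complete R xs → Unique xs → Linked R xs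
  complete⇒linked {xs = []} _ _ = []
  complete⇒linked {xs = x ∷ []} _ _ = [-]
  complete⇒linked {xs = x ∷ y ∷ xs} c ((x≢y ∷ _) ∷ u) =
    c (here refl) (there (here refl)) x≢y ∷ complete⇒linked (λ a b → c (there a) (there b)) u

  complete-⊆ : ∀ {R : A → A → Set} {C C'} → Complete R C → (∀ {z} → z ∈ C' → z ∈ C) → Complete R C'
  complete-⊆ c C'⊆C a∈ b∈ = c (C'⊆C a∈) (C'⊆C b∈)

  linked-join : ∀ {R : A → A → Set} xs {z ys} →
    Linked R (xs ++ z ∷ []) → Linked R (z ∷ ys) → Linked R (xs ++ z ∷ ys)
  linked-join [] _ l = l
  linked-join (a ∷ []) (r ∷ _) l = r ∷ l
  linked-join (a ∷ b ∷ xs) (r ∷ l₁) l = r ∷ linked-join (b ∷ xs) l₁ l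

  linked-++⁻ˡ : ∀ {R : A → A → Set} xs {ys} → Linked R (xs ++ ys) → Linked R xs
  linked-++⁻ˡ [] _ = []
  linked-++⁻ˡ (a ∷ []) _ = [-]
  linked-++⁻ˡ (a ∷ b ∷ xs) (r ∷ l) = r ∷ linked-++⁻ˡ (b ∷ xs) l

  linked-++⁻ʳ : ∀ {R : A → A → Set} xs {ys} → Linked R (xs ++ ys) → Linked R ys
  linked-++⁻ʳ [] l = l
  linked-++⁻ʳ (a ∷ xs) l = linked-++⁻ʳ xs (Linked.tail l)

  linked-reverse : ∀ {R : A → A → Set} → (∀ {a b} → R a b → R b a) →
    ∀ {xs} → Linked R xs → Linked R (reverse xs)
  linked-reverse sym-R [] = []
  linked-reverse sym-R [-] = [-]
  linked-reverse {R} sym-R {x ∷ y ∷ xs} (r ∷ l)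
    rewrite List.unfold-reverse x (y ∷ xs) | List.unfold-reverse y xs | List.++-assoc (reverse xs) (y ∷ []) (x ∷ []) =
    linked-join (reverse xs) (subst (Linked R) (List.unfold-reverse y xs) (linked-reverse sym-R l)) (sym-R r ∷ [-])

  unique-++⁻ʳ : ∀ (xs : List A) {ys} → Unique (xs ++ ys) → Unique ys
  unique-++⁻ʳ [] u = u
  unique-++⁻ʳ (a ∷ xs) (_ ∷ u) = unique-++⁻ʳ xs u

  unique-∷ʳ : ∀ {xs : List A} {x} → Unique xs → x ∉ xs → Unique (xs ++ x ∷ [])
  unique-∷ʳ u x∉ = Unique.++⁺ u ([] ∷ []) λ { (p , here refl) → x∉ p }

  unique-reverse : ∀ {xs} → Unique xs → Unique (reverse xs)
  unique-reverse [] = []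
  unique-reverse {x ∷ xs} (x∉ ∷ u) rewrite List.unfold-reverse x xs =
    unique-∷ʳ (unique-reverse u) (λ p → All.lookup x∉ (Perm.∈-resp-↭ (Perm.↭-reverse xs) p) refl)

  record Removal (C : List A) (a : A) : Set where
    field
      rest : List A
      unique : Unique (a ∷ rest)
      length-rest : suc (length rest) ≡ length C
      rest⊆ : ∀ {z} → z ∈ rest → z ∈ C
      ⊆rest : ∀ {z} → z ∈ C → z ≢ a → z ∈ rest

  ∉-rest : ∀ {C a} (R : Removal C a) {z} → z ∈ Removal.rest R → a ≢ z
  ∉-rest R = All.lookup (AllPairs.head (Removal.unique R))

  rest-∷ʳ-unique : ∀ {C a} (R : Removal C a) → Unique (Removal.rest R ++ a ∷ [])
  rest-∷ʳ-unique R = unique-∷ʳ (AllPairs.tail (Removal.unique R)) (λ a∈ → ∉-rest R a∈ refl)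

  ∈-take⁻ : ∀ r {z} (xs : List A) → z ∈ take r xs → z ∈ xs
  ∈-take⁻ (suc r) (x ∷ xs) (here e) = here e
  ∈-take⁻ (suc r) (x ∷ xs) (there p) = there (∈-take⁻ r xs p)

  module _ (_≟ₐ_ : DecidableEquality A) where

    private
      length-filter-≢ : ∀ {z xs} → Unique xs → z ∈ xs → suc (length (filter (λ a → ¬? (a ≟ₐ z)) xs)) ≡ length xs
      length-filter-≢ {xs = x ∷ xs} (x∉ ∷ _) (here refl) = cong (suc ∘ length) (trans
        (List.filter-reject (λ a → ¬? (a ≟ₐ x)) (λ x≢x → x≢x refl))
        (List.filter-all (λ a → ¬? (a ≟ₐ x)) (All.map (λ x≢y y≡x → x≢y (sym y≡x)) x∉)))
      length-filter-≢ {z} {x ∷ xs} (x∉ ∷ u) (there p) = trans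
        (cong (suc ∘ length) (List.filter-accept (λ a → ¬? (a ≟ₐ z)) (All.lookup x∉ p)))
        (cong suc (length-filter-≢ u p))

    remove : ∀ {C a} → Unique C → a ∈ C → Removal C a
    remove {C} {a} uC a∈C = record
      { rest = filter (λ z → ¬? (z ≟ₐ a)) C
      ; unique = All.tabulate (λ z∈ a≡z → proj₂ (∈-filter⁻ (λ z → ¬? (z ≟ₐ a)) {xs = C} z∈) (sym a≡z))
               ∷ Unique.filter⁺ _ uC
      ; length-rest = length-filter-≢ uC a∈C
      ; rest⊆ = λ z∈ → proj₁ (∈-filter⁻ (λ z → ¬? (z ≟ₐ a)) {xs = C} z∈)
      ; ⊆rest = ∈-filter⁺ (λ z → ¬? (z ≟ₐ a))
      }

    unique-sublist-∋₂ : ∀ r {C a b} → Unique C → a ∈ C → b ∈ C → a ≢ b →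
      2 + r ≤ length C → ∃ λ D → Unique (a ∷ b ∷ D) × length D ≡ r × (∀ {z} → z ∈ D → z ∈ C)
    unique-sublist-∋₂ r {C} {a} {b} uC a∈C b∈C a≢b 2+r≤∣C∣ =
      D , All.tabulate a∉ ∷ All.tabulate b∉ ∷ Unique.take⁺ r (AllPairs.tail (Removal.unique C-b)) ,
      length-D , Removal.rest⊆ C-a ∘ Removal.rest⊆ C-b ∘ ∈-take⁻ r _
      where
        C-a = remove uC a∈C
        C-b = remove (AllPairs.tail (Removal.unique C-a)) (Removal.⊆rest C-a b∈C (λ b≡a → a≢b (sym b≡a)))
        D = take r (Removal.rest C-b)
        b∉ : ∀ {z} → z ∈ D → b ≢ z
        b∉ = ∉-rest C-b ∘ ∈-take⁻ r _
        a∉ : ∀ {z} → z ∈ b ∷ D → a ≢ z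
        a∉ (here refl) = a≢b
        a∉ (there z∈D) = ∉-rest C-a (Removal.rest⊆ C-b (∈-take⁻ r _ z∈D))
        length-D : length D ≡ r
        length-D = trans (List.length-take r _) (ℕ.m≤n⇒m⊓n≡m (ℕ.+-cancelˡ-≤ 2 r _ (subst (2 + r ≤_)
          (sym (trans (cong suc (Removal.length-rest C-b)) (Removal.length-rest C-a))) 2+r≤∣C∣)))

  length-∷ʳ : ∀ (xs : List A) {y} → length (xs ++ y ∷ []) ≡ suc (length xs)
  length-∷ʳ xs = trans (List.length-++ xs) (ℕ.+-comm (length xs) 1)

  All-≢ : ∀ {P : A → Set} {a xs} → ¬ P a → All P xs → All (a ≢_) xs
  All-≢ {P} ¬pa = All.map λ pz a≡z → ¬pa (subst P (sym a≡z) pz)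

  linked-propagate : ∀ {P Q : A → Set} {R : A → A → Set} →
    (∀ {a b} → Q a → Q b → R a b → P a → P b) →
    ∀ {x xs} → All Q (x ∷ xs) → Linked R (x ∷ xs) → P x → All P (x ∷ xs)
  linked-propagate preserve (_ ∷ []) [-] px = px ∷ []
  linked-propagate preserve (qx ∷ qy ∷ qs) (r ∷ l) px =
    px ∷ linked-propagate preserve (qy ∷ qs) l (preserve qx qy r px)

  ↭-unique : ∀ {xs ys : List A} → Unique xs → Unique ys →
    (∀ {z} → z ∈ xs → z ∈ ys) → (∀ {z} → z ∈ ys → z ∈ xs) → xs ↭ ys
  ↭-unique ux uy f g = ∼bag⇒↭ (unique∧set⇒bag ux uy (mk⇔ f g))

  count-↭ : ∀ (p : A → Bool) {xs ys} → xs ↭ ys → count p xs ≡ count p ys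
  count-↭ p xs↭ys = Perm.↭-length (Perm.filter-↭ (T? ∘ p) xs↭ys)

  count-cong : ∀ {p q : A → Bool} → (∀ a → p a ≡ q a) → ∀ xs → count p xs ≡ count q xs
  count-cong {p} {q} p≗q xs = cong length
    (List.filter-≐ (T? ∘ p) (T? ∘ q) ((λ {a} → subst T (p≗q a)) , (λ {a} → subst T (sym (p≗q a)))) xs)

  count-map : ∀ {B : Set} (p : B → Bool) (f : A → B) xs → count (p ∘ f) xs ≡ count p (map f xs)
  count-map p f [] = refl
  count-map p f (x ∷ xs) with p (f x)
  ... | true = cong suc (count-map p f xs)
  ... | false = count-map p f xs

  count-mono : ∀ {p q : A → Bool} → (∀ a → T (p a) → T (q a)) → ∀ xs → count p xs ≤ count q xs
  count-mono {p} {q} p⇒q [] = z≤n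
  count-mono {p} {q} p⇒q (x ∷ xs) with p x | q x | p⇒q x
  ... | true | true | _ = s≤s (count-mono p⇒q xs)
  ... | true | false | f = ⊥-elim (f _)
  ... | false | true | _ = ℕ.m≤n⇒m≤1+n (count-mono p⇒q xs)
  ... | false | false | _ = count-mono p⇒q xs

  count-< : ∀ {p q : A → Bool} → (∀ a → T (p a) → T (q a)) → ∀ {z xs} → z ∈ xs → T (q z) → ¬ T (p z) →
    count p xs < count q xs
  count-< {p} {q} p⇒q {xs = x ∷ xs} (here refl) qz ¬pz with p x | q x
  ... | true | _ = ⊥-elim (¬pz _)
  ... | false | true = s≤s (count-mono p⇒q xs)
  count-< {p} {q} p⇒q {xs = x ∷ xs} (there z∈xs) qz ¬pz with p x | q x | p⇒q x
  ... | true | true | _ = s≤s (count-< p⇒q z∈xs qz ¬pz)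
  ... | true | false | f = ⊥-elim (f _)
  ... | false | true | _ = ℕ.m≤n⇒m≤1+n (count-< p⇒q z∈xs qz ¬pz)
  ... | false | false | _ = count-< p⇒q z∈xs qz ¬pz

  count-∘-bijection : ∀ (p : A → Bool) {xs} → Unique xs → (∀ a → a ∈ xs) →
    (σ τ : A → A) → (∀ a → σ (τ a) ≡ a) → (∀ a → τ (σ a) ≡ a) → count (p ∘ σ) xs ≡ count p xs
  count-∘-bijection p {xs} uxs complete σ τ στ τσ = trans (count-map p σ xs)
    (count-↭ p (↭-unique
      (Unique.map⁺ (λ {a} {b} e → trans (sym (τσ a)) (trans (cong τ e) (τσ b))) uxs)
      uxs
      (λ _ → complete _)
      (λ {a} _ → subst (_∈ map σ xs) (στ a) (∈-map⁺ σ (complete (τ a))))))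

-- Subsets and graphs

∣∣≡count : ∀ {m} (S : Subset m) → ∣ S ∣ ≡ count (lookup S) (allFin m)
∣∣≡count-suc : ∀ {m} b (S : Subset m) → ∣ S ∣ ≡ count (lookup (b Vec.∷ S)) (tabulate Fin.suc)

∣∣≡count Vec.[] = refl
∣∣≡count (true Vec.∷ S) = cong suc (∣∣≡count-suc true S)
∣∣≡count (false Vec.∷ S) = ∣∣≡count-suc false S

∣∣≡count-suc {m} b S = trans (∣∣≡count S) (trans
  (count-map (lookup (b Vec.∷ S)) Fin.suc (allFin m))
  (cong (count (lookup (b Vec.∷ S))) (List.map-tabulate (λ i → i) Fin.suc)))

module _ {n : ℕ} where

  ∈-allSubsets : ∀ m (S : Subset m) → S ∈ allSubsets {n} m
  ∈-allSubsets zero Vec.[] = here refl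
  ∈-allSubsets (suc m) (true Vec.∷ S) = ∈-++⁺ˡ (∈-map⁺ (true Vec.∷_) (∈-allSubsets m S))
  ∈-allSubsets (suc m) (false Vec.∷ S) =
    ∈-++⁺ʳ (map (true Vec.∷_) (allSubsets {n} m)) (∈-map⁺ (false Vec.∷_) (∈-allSubsets m S))

  allSubsets-unique : ∀ m → Unique (allSubsets {n} m)
  allSubsets-unique zero = [] ∷ []
  allSubsets-unique (suc m) =
    Unique.++⁺ (Unique.map⁺ ∷-injectiveʳ (allSubsets-unique m)) (Unique.map⁺ ∷-injectiveʳ (allSubsets-unique m))
      λ (t , f) → disjoint t f
    where
      ∷-injectiveʳ : ∀ {b} {S T : Subset m} → b Vec.∷ S ≡ b Vec.∷ T → S ≡ T
      ∷-injectiveʳ refl = refl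
      disjoint : ∀ {S} → S ∈ map (true Vec.∷_) (allSubsets {n} m) → S ∈ map (false Vec.∷_) (allSubsets {n} m) → ⊥
      disjoint t f with ∈-map⁻ (true Vec.∷_) t | ∈-map⁻ (false Vec.∷_) f
      ... | _ , _ , refl | _ , _ , ()


module _ {n : ℕ} where

  open import Data.List.Membership.DecPropositional (_≟_ {n}) using (_∈?_)

  ==-refl : ∀ (a : Fin n) → (a == a) ≡ true
  ==-refl a with a ≟ a
  ... | yes _ = refl
  ... | no a≢a = ⊥-elim (a≢a refl)

  ≢⇒==-false : ∀ {a b : Fin n} → a ≢ b → (a == b) ≡ false
  ≢⇒==-false {a} {b} a≢b with a ≟ b
  ... | yes a≡b = ⊥-elim (a≢b a≡b)
  ... | no _ = refl

  Adj⇔ : ∀ {G : Graph n} {a b} → Adj G a b ⇔ (a ≢ b × (T (G a b) ⊎ T (G b a)))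
  Adj⇔ {G} {a} {b} with a ≟ b
  ... | yes a≡b = mk⇔ (λ ()) (λ (a≢b , _) → a≢b a≡b)
  ... | no a≢b = mk⇔ (λ t → a≢b , Equivalence.to T-∨ t) (λ (_ , o) → Equivalence.from (T-∨ {G a b} {G b a}) o)

  adj-irrefl : ∀ {G : Graph n} {a b} → Adj G a b → a ≢ b
  adj-irrefl {G} {a} {b} = proj₁ ∘ Equivalence.to (Adj⇔ {G} {a} {b})

  adj-sym : ∀ {G : Graph n} {a b} → Adj G a b → Adj G b a
  adj-sym {G} {a} {b} t with Equivalence.to (Adj⇔ {G} {a} {b}) t
  ... | a≢b , o = Equivalence.from (Adj⇔ {G} {b} {a}) ((λ b≡a → a≢b (sym b≡a)) , swap o)


  module _ (G : Graph n) {x u : Fin n} (x≢u : x ≢ u) where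

    private
      G' : Graph n
      G' = switch G x u

    switch-away : ∀ {a b} → a ≢ x → a ≢ u → b ≢ x → b ≢ u → G' a b ≡ edge G a b
    switch-away a≢x a≢u b≢x b≢u
      rewrite ≢⇒==-false a≢x | ≢⇒==-false a≢u | ≢⇒==-false b≢x | ≢⇒==-false b≢u = refl

    switch-from-x : ∀ {b} → b ≢ u → G' x b ≡ edge G x b ∧ edge G u b
    switch-from-x b≢u rewrite ==-refl x | ≢⇒==-false b≢u = refl

    switch-to-x : ∀ {b} → b ≢ x → b ≢ u → G' b x ≡ false
    switch-to-x b≢x b≢u rewrite ≢⇒==-false b≢x | ≢⇒==-false b≢u | ==-refl x = refl

    switch-from-u : ∀ {b} → G' u b ≡ edge G u b ∨ (edge G x b ∧ not (b == u))
    switch-from-u rewrite ≢⇒==-false (λ u≡x → x≢u (sym u≡x)) | ==-refl u = refl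

    Adj-switch-away : ∀ {a b} → a ≢ x → a ≢ u → b ≢ x → b ≢ u → Adj G' a b ⇔ Adj G a b
    Adj-switch-away {a} {b} a≢x a≢u b≢x b≢u = mk⇔ to from
      where
        to : Adj G' a b → Adj G a b
        to t with proj₂ (Equivalence.to (Adj⇔ {G'} {a} {b}) t)
        ... | inj₁ h = subst T (switch-away a≢x a≢u b≢x b≢u) h
        ... | inj₂ h = adj-sym {G} {b} {a} (subst T (switch-away b≢x b≢u a≢x a≢u) h)
        from : Adj G a b → Adj G' a b
        from t = Equivalence.from (Adj⇔ {G'} {a} {b})
          (adj-irrefl {G} t , inj₁ (subst T (sym (switch-away a≢x a≢u b≢x b≢u)) t))

    Adj-switch-x : ∀ {b} → b ≢ x → b ≢ u → Adj G' x b ⇔ (Adj G x b × Adj G u b)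
    Adj-switch-x {b} b≢x b≢u = mk⇔ to from
      where
        to : Adj G' x b → Adj G x b × Adj G u b
        to t with proj₂ (Equivalence.to (Adj⇔ {G'} {x} {b}) t)
        ... | inj₁ h = Equivalence.to T-∧ (subst T (switch-from-x b≢u) h)
        ... | inj₂ h = ⊥-elim (subst T (switch-to-x b≢x b≢u) h)
        from : Adj G x b × Adj G u b → Adj G' x b
        from (xb , ub) = Equivalence.from (Adj⇔ {G'} {x} {b})
          ((λ x≡b → b≢x (sym x≡b)) , inj₁ (subst T (sym (switch-from-x b≢u)) (Equivalence.from T-∧ (xb , ub))))

    Adj-switch⇒Adj : ∀ {a b} → a ≢ u → b ≢ u → Adj G' a b → Adj G a b
    Adj-switch⇒Adj {a} {b} a≢u b≢u t = by-cases (a ≟ x) (b ≟ x)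
      where
        by-cases : Dec (a ≡ x) → Dec (b ≡ x) → Adj G a b
        by-cases (yes a≡x) _ = subst (λ z → Adj G z b) (sym a≡x)
          (proj₁ (Equivalence.to (Adj-switch-x (λ b≡x → adj-irrefl {G'} t (trans a≡x (sym b≡x))) b≢u)
            (subst (λ z → Adj G' z b) a≡x t)))
        by-cases (no _) (yes b≡x) = subst (Adj G a) (sym b≡x) (adj-sym {G}
          (proj₁ (Equivalence.to (Adj-switch-x (λ a≡x → adj-irrefl {G'} t (trans a≡x (sym b≡x))) a≢u)
            (subst (λ z → Adj G' z a) b≡x (adj-sym {G'} {a} {b} t)))))
        by-cases (no a≢x) (no b≢x) = Equivalence.to (Adj-switch-away a≢x a≢u b≢x b≢u) t
    Adj-switch-u : ∀ {b} → Adj G u b → Adj G' u b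
    Adj-switch-u {b} t = Equivalence.from (Adj⇔ {G'} {u} {b})
      (adj-irrefl {G} t , inj₁ (subst T (sym switch-from-u) (Equivalence.from (T-∨ {edge G u b}) (inj₁ t))))


  -- The loop-erased walk up to its first vertex p in P.
  walk⇒path-to : ∀ {G : Graph n} {D P : Fin n → Set} → U.Decidable P →
    ∀ {a b} → ¬ P a → ¬ D a → P b → Walk G D a b →
    ∃ λ π → ∃ λ p → P p × Unique (a ∷ π) × All (λ z → ¬ D z × ¬ P z) (a ∷ π) ×
                    Linked (Adj G) (a ∷ π ++ p ∷ [])
  walk⇒path-to P? ¬Pa ¬Da Pb here = ⊥-elim (¬Pa Pb)
  walk⇒path-to {G} {D} {P} P? {a} ¬Pa ¬Da Pc (step {b = b} ab ¬Db w) with P? b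
  ... | yes Pb = [] , b , Pb , [] ∷ [] , (¬Da , ¬Pa) ∷ [] , ab ∷ [-]
  ... | no ¬Pb with walk⇒path-to P? ¬Pb ¬Db Pc w
  ...   | π , p , Pp , uπ , allπ , lkπ with a ∈? b ∷ π
  ...     | no a∉ = b ∷ π , p , Pp , All.tabulate (λ z∈ a≡z → a∉ (subst (_∈ b ∷ π) (sym a≡z) z∈)) ∷ uπ ,
                    (¬Da , ¬Pa) ∷ allπ , ab ∷ lkπ
  ...     | yes a∈ with ∈-∃++ a∈
  ...       | pre , post , split = post , p , Pp ,
    unique-++⁻ʳ pre (subst Unique split uπ) ,
    All.++⁻ʳ pre (subst (All _) split allπ) ,
    linked-++⁻ʳ pre (subst (Linked (Adj G)) (trans (cong (_++ p ∷ []) split) (List.++-assoc pre (a ∷ post) (p ∷ []))) lkπ)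

  walk-crosses : ∀ {G : Graph n} {D : Fin n → Set} (f : Fin n → ℕ) {a b} → ¬ D a → Walk G D a b → f a ≢ f b →
    ∃ λ a' → ∃ λ b' → ¬ D a' × ¬ D b' × Adj G a' b' × f a' ≢ f b'
  walk-crosses f ¬Da here fa≢fa = ⊥-elim (fa≢fa refl)
  walk-crosses f {a} ¬Da (step {b = b} ab ¬Db w) fa≢fc with f a ℕ.≟ f b
  ... | yes fa≡fb = walk-crosses f ¬Db w (fa≢fc ∘ trans fa≡fb)
  ... | no fa≢fb = a , b , ¬Da , ¬Db , ab , fa≢fb

  Clique : Graph n → Subset n → Set
  Clique G S = ∀ i j → T (lookup S i) → T (lookup S j) → i ≢ j → Adj G i j

  T-allB : ∀ {A : Set} (p : A → Bool) xs → T (allB {n} p xs) ⇔ (∀ {a} → a ∈ xs → T (p a))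
  T-allB p [] = mk⇔ (λ _ ()) (λ _ → tt)
  T-allB p (x ∷ xs) = mk⇔
    (λ t → λ { (here refl) → proj₁ (Equivalence.to T-∧ t)
             ; (there a∈xs) → Equivalence.to (T-allB p xs) (proj₂ (Equivalence.to T-∧ t)) a∈xs })
    (λ all-p → Equivalence.from T-∧ (all-p (here refl) , Equivalence.from (T-allB p xs) (λ a∈xs → all-p (there a∈xs))))

  T-implication : ∀ a b c e → T (not (a ∧ b ∧ not c) ∨ e) ⇔ (T a → T b → ¬ T c → T e)
  T-implication false b c e = mk⇔ (λ _ ()) (λ _ → tt)
  T-implication true false c e = mk⇔ (λ _ _ ()) (λ _ → tt)
  T-implication true true true e = mk⇔ (λ _ _ _ ¬c → ⊥-elim (¬c tt)) (λ _ → tt)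
  T-implication true true false e = mk⇔ (λ t _ _ _ → t) (λ f → f tt tt (λ ()))

  isClique⇔ : ∀ {G S} → T (isClique G S) ⇔ Clique G S
  isClique⇔ {G} {S} = mk⇔
    (λ t i j si sj i≢j → Equivalence.to (T-implication (lookup S i) (lookup S j) (i == j) (edge G i j))
      (Equivalence.to (T-allB _ (allFin n)) (Equivalence.to (T-allB _ (allFin n)) t (∈-allFin i)) (∈-allFin j))
      si sj (i≢j ∘ T-does⁻ (i ≟ j)))
    (λ c → Equivalence.from (T-allB _ (allFin n)) λ {i} _ → Equivalence.from (T-allB _ (allFin n)) λ {j} _ →
      Equivalence.from (T-implication (lookup S i) (lookup S j) (i == j) (edge G i j))
        (λ si sj ¬i==j → c i j si sj (¬i==j ∘ T-does⁺ (i ≟ j))))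

  toSubset : List (Fin n) → Subset n
  toSubset xs = Vec.tabulate (λ i → does (i ∈? xs))

  ∈-toSubset⁻ : ∀ {xs i} → T (lookup (toSubset xs) i) → i ∈ xs
  ∈-toSubset⁻ {xs} {i} t = T-does⁻ (i ∈? xs) (subst T (Vec.lookup∘tabulate _ i) t)

  ∈-toSubset⁺ : ∀ {xs i} → i ∈ xs → T (lookup (toSubset xs) i)
  ∈-toSubset⁺ {xs} {i} i∈xs = subst T (sym (Vec.lookup∘tabulate _ i)) (T-does⁺ (i ∈? xs) i∈xs)

  ∣toSubset∣ : ∀ {xs} → Unique xs → ∣ toSubset xs ∣ ≡ length xs
  ∣toSubset∣ {xs} uxs = trans (∣∣≡count (toSubset xs)) (trans
    (count-cong (Vec.lookup∘tabulate _) (allFin n))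
    (Perm.↭-length (↭-unique (Unique.filter⁺ _ (Unique.allFin⁺ n)) uxs
      (λ {z} z∈ → T-does⁻ (z ∈? xs) (proj₂ (∈-filter⁻ (λ i → T? (does (i ∈? xs))) {xs = allFin n} z∈)))
      (λ {z} z∈xs → ∈-filter⁺ (λ i → T? (does (i ∈? xs))) (∈-allFin z) (T-does⁺ (z ∈? xs) z∈xs)))))

  ⊆-N≡⇒Clique : ∀ s {H M : Graph n} → H ⊆G M → N s H ≡ N s M →
    ∀ S → ∣ S ∣ ≡ s → Clique M S → Clique H S
  ⊆-N≡⇒Clique s {H} {M} H⊆M N≡ S ∣S∣≡s cM = Equivalence.to (isClique⇔ {H} {S})
    (decidable-stable (T? (isClique H S)) λ ¬cH → ℕ.<-irrefl N≡
      (count-< s-clique-mono (∈-allSubsets {n} n S)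
        (Equivalence.from T-∧ (ℕ.≡⇒≡ᵇ ∣ S ∣ s ∣S∣≡s , Equivalence.from (isClique⇔ {M} {S}) cM))
        (¬cH ∘ proj₂ ∘ Equivalence.to T-∧)))
    where
      s-clique-mono : ∀ S' → T ((∣ S' ∣ ≡ᵇ s) ∧ isClique H S') → T ((∣ S' ∣ ≡ᵇ s) ∧ isClique M S')
      s-clique-mono S' t with Equivalence.to T-∧ t
      ... | ∣S'∣ , cH = Equivalence.from T-∧ (∣S'∣ , Equivalence.from (isClique⇔ {M} {S'})
        λ i j si sj i≢j → H⊆M i j (Equivalence.to (isClique⇔ {H} {S'}) cH i j si sj i≢j))

  ⊆-N≡⇒Complete : ∀ s {H M : Graph n} → H ⊆G M → N s H ≡ N s M → 2 ≤ s →
    ∀ {C} → Unique C → s ≤ length C → Complete (Adj M) C → Complete (Adj H) C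
  ⊆-N≡⇒Complete s {H} {M} H⊆M N≡ 2≤s {C} uC s≤∣C∣ cM {a} {b} a∈C b∈C a≢b
    with unique-sublist-∋₂ _≟_ (s ∸ 2) uC a∈C b∈C a≢b (subst (_≤ length C) (sym (ℕ.m+[n∸m]≡n 2≤s)) s≤∣C∣)
  ... | D , uD , ∣D∣ , D⊆C =
    ⊆-N≡⇒Clique s {H} {M} H⊆M N≡ (toSubset (a ∷ b ∷ D))
      (trans (∣toSubset∣ uD) (trans (cong (2 +_) ∣D∣) (ℕ.m+[n∸m]≡n 2≤s)))
      (λ i j si sj → cM (⊆C (∈-toSubset⁻ {a ∷ b ∷ D} si)) (⊆C (∈-toSubset⁻ {a ∷ b ∷ D} sj)))
      a b (∈-toSubset⁺ {a ∷ b ∷ D} (here refl)) (∈-toSubset⁺ {a ∷ b ∷ D} (there (here refl))) a≢b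
    where
      ⊆C : ∀ {z} → z ∈ a ∷ b ∷ D → z ∈ C
      ⊆C (here refl) = a∈C
      ⊆C (there (here refl)) = b∈C
      ⊆C (there (there z∈D)) = D⊆C z∈D

  CycleThrough-sym : ∀ {G : Graph n} {a b L} → CycleThrough G a b L → CycleThrough G b a L
  CycleThrough-sym {G} {a} {b} (mid , uq , lk , len , 3≤L , ab) =
    reverse mid ,
    subst Unique reverse-cycle (unique-reverse uq) ,
    subst (Linked (Adj G)) reverse-cycle (linked-reverse (adj-sym {G}) lk) ,
    trans (cong length (sym reverse-cycle)) (trans (List.length-reverse (a ∷ mid ++ b ∷ [])) len) ,
    3≤L ,
    adj-sym {G} ab
    where
      reverse-cycle : reverse (a ∷ mid ++ b ∷ []) ≡ b ∷ reverse mid ++ a ∷ []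
      reverse-cycle = trans (List.unfold-reverse a (mid ++ b ∷ [])) (cong (_++ a ∷ []) (List.reverse-++ mid (b ∷ [])))

  cLe-sym : ∀ {G : Graph n} {a b k} → cLe G a b k → cLe G b a k
  cLe-sym {G} c L cyc = c L (CycleThrough-sym {G} cyc)

  cLe⇒¬cGt : ∀ {G : Graph n} {a b k} → cLe G a b k → ¬ cGt G a b k
  cLe⇒¬cGt c (L , k<L , cyc) = ℕ.<⇒≱ k<L (c L cyc)

  cGt-intro : ∀ {G : Graph n} {a b k} → 2 ≤ k → (mid : List (Fin n)) →
    Unique (a ∷ mid ++ b ∷ []) → Linked (Adj G) (a ∷ mid ++ b ∷ []) → Adj G a b →
    k < length (a ∷ mid ++ b ∷ []) → cGt G a b k
  cGt-intro 2≤k mid uq lk ab k<L = _ , k<L , mid , uq , lk , refl , ℕ.≤-trans (s≤s 2≤k) k<L , ab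

  module _ {G H : Graph n} (φ : G ≅ H) where

    private
      to from : Fin n → Fin n
      to = Inverse.to (proj₁ φ)
      from = Inverse.from (proj₁ φ)
      to∘from : ∀ y → to (from y) ≡ y
      to∘from = Inverse.strictlyInverseˡ (proj₁ φ)
      from∘to : ∀ x → from (to x) ≡ x
      from∘to = Inverse.strictlyInverseʳ (proj₁ φ)

    ≅-reflects-Adj : ∀ {a b} → Adj H a b → Adj G (from a) (from b)
    ≅-reflects-Adj {a} {b} t = proj₂ (proj₂ φ (from a) (from b)) (subst₂ (Adj H) (sym (to∘from a)) (sym (to∘from b)) t)

    ≅-reflects-cGt : ∀ {a b k} → cGt H (to a) (to b) k → cGt G a b k
    ≅-reflects-cGt {a} {b} (L , k<L , mid , uq , lk , len , 3≤L , ab) =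
      L , k<L , map from mid ,
      subst Unique mapped (Unique.map⁺ from-injective uq) ,
      subst (Linked (Adj G)) mapped (Linked.map⁺ (Linked.map ≅-reflects-Adj lk)) ,
      trans (cong length (sym mapped)) (trans (List.length-map from (to a ∷ mid ++ to b ∷ [])) len) ,
      3≤L ,
      subst₂ (Adj G) (from∘to a) (from∘to b) (≅-reflects-Adj ab)
      where
        from-injective : ∀ {y z} → from y ≡ from z → y ≡ z
        from-injective {y} {z} e = trans (sym (to∘from y)) (trans (cong to e) (to∘from z))
        mapped : map from (to a ∷ mid ++ to b ∷ []) ≡ a ∷ map from mid ++ b ∷ []
        mapped = cong₂ _∷_ (from∘to a)
          (trans (List.map-++ from mid (to b ∷ [])) (cong (λ z → map from mid ++ z ∷ []) (from∘to b)))

    private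
      image preimage : Subset n → Subset n
      image S = Vec.tabulate (lookup S ∘ from)
      preimage S = Vec.tabulate (lookup S ∘ to)

      image-preimage : ∀ S → image (preimage S) ≡ S
      image-preimage S = trans
        (Vec.tabulate-cong λ j → trans (Vec.lookup∘tabulate _ (from j)) (cong (lookup S) (to∘from j)))
        (Vec.tabulate∘lookup S)

      preimage-image : ∀ S → preimage (image S) ≡ S
      preimage-image S = trans
        (Vec.tabulate-cong λ i → trans (Vec.lookup∘tabulate _ (to i)) (cong (lookup S) (from∘to i)))
        (Vec.tabulate∘lookup S)

      ∣image∣ : ∀ S → ∣ image S ∣ ≡ ∣ S ∣
      ∣image∣ S = begin
        ∣ image S ∣                          ≡⟨ ∣∣≡count (image S) ⟩
        count (lookup (image S)) (allFin n)  ≡⟨ count-cong (Vec.lookup∘tabulate _) (allFin n) ⟩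
        count (lookup S ∘ from) (allFin n)
          ≡⟨ count-∘-bijection (lookup S) (Unique.allFin⁺ n) ∈-allFin from to from∘to to∘from ⟩
        count (lookup S) (allFin n)          ≡⟨ ∣∣≡count S ⟨
        ∣ S ∣                                ∎

      Clique-image : ∀ S → Clique G S ⇔ Clique H (image S)
      Clique-image S = mk⇔
        (λ c i j si sj i≢j → subst₂ (Adj H) (to∘from i) (to∘from j) (proj₁ (proj₂ φ (from i) (from j))
          (c (from i) (from j) (subst T (Vec.lookup∘tabulate _ i) si) (subst T (Vec.lookup∘tabulate _ j) sj)
             (λ e → i≢j (trans (sym (to∘from i)) (trans (cong to e) (to∘from j)))))))
        (λ c i j si sj i≢j → proj₂ (proj₂ φ i j)
          (c (to i) (to j) (subst T (sym (lookup-image-to S i)) si) (subst T (sym (lookup-image-to S j)) sj)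
             (λ e → i≢j (trans (sym (from∘to i)) (trans (cong from e) (from∘to j))))))
        where
          lookup-image-to : ∀ S i → lookup (image S) (to i) ≡ lookup S i
          lookup-image-to S i = trans (Vec.lookup∘tabulate _ (to i)) (cong (lookup S) (from∘to i))

    ≅-preserves-N : ∀ s → N s G ≡ N s H
    ≅-preserves-N s = begin
      count s-clique-of-G (allSubsets {n} n)            ≡⟨ count-cong same-test (allSubsets {n} n) ⟩
      count (s-clique-of-H ∘ image) (allSubsets {n} n)
        ≡⟨ count-∘-bijection s-clique-of-H (allSubsets-unique {n} n) (∈-allSubsets {n} n)
             image preimage image-preimage preimage-image ⟩
      count s-clique-of-H (allSubsets {n} n)            ∎
      where
        s-clique-of-G s-clique-of-H : Subset n → Bool
        s-clique-of-G S = (∣ S ∣ ≡ᵇ s) ∧ isClique G S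
        s-clique-of-H S = (∣ S ∣ ≡ᵇ s) ∧ isClique H S
        same-test : ∀ S → s-clique-of-G S ≡ s-clique-of-H (image S)
        same-test S = cong₂ _∧_ (cong (_≡ᵇ s) (sym (∣image∣ S))) (T-ext
          (Equivalence.from (isClique⇔ {H} {image S}) ∘ Equivalence.to (Clique-image S) ∘ Equivalence.to (isClique⇔ {G} {S}))
          (Equivalence.from (isClique⇔ {G} {S}) ∘ Equivalence.from (Clique-image S) ∘ Equivalence.to (isClique⇔ {H} {image S})))

-- The graph X n k

module ExtremalGraph (d n : ℕ) (k+1≤n : 4 + d ≤ n) where

  k K : ℕ
  k = 3 + d
  K = 1 + d

  Hub : Fin n → Set
  Hub i = toℕ i < 2

  block : Fin n → ℕ
  block i = (toℕ i ∸ 2) / K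

  InBlock : ℕ → Fin n → Set
  InBlock β i = 2 ≤ toℕ i × block i ≡ β

  Near : Fin n → Fin n → Set
  Near i j = Hub i ⊎ Hub j ⊎ block i ≡ block j

  T-X⇔Near : ∀ {i j} → T (X n k i j) ⇔ Near i j
  T-X⇔Near {i} {j} with toℕ i <ᵇ 2 in i<2 | toℕ j <ᵇ 2 in j<2
  ... | true | _ = mk⇔ (λ _ → inj₁ (ℕ.<ᵇ⇒< (toℕ i) 2 (subst T (sym i<2) tt))) (λ _ → tt)
  ... | false | true = mk⇔ (λ _ → inj₂ (inj₁ (ℕ.<ᵇ⇒< (toℕ j) 2 (subst T (sym j<2) tt)))) (λ _ → tt)
  ... | false | false = mk⇔ (inj₂ ∘ inj₂ ∘ ℕ.≡ᵇ⇒≡ _ _) λ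
    { (inj₁ i<2') → ⊥-elim (subst T i<2 (ℕ.<⇒<ᵇ i<2'))
    ; (inj₂ (inj₁ j<2')) → ⊥-elim (subst T j<2 (ℕ.<⇒<ᵇ j<2'))
    ; (inj₂ (inj₂ e)) → ℕ.≡⇒≡ᵇ _ _ e }

  Adj-X⇔ : ∀ {i j} → Adj (X n k) i j ⇔ (i ≢ j × Near i j)
  Adj-X⇔ {i} {j} = mk⇔
    (λ t → case Equivalence.to (Adj⇔ {G = X n k} {a = i} {b = j}) t of λ
      { (i≢j , inj₁ ij) → i≢j , Equivalence.to T-X⇔Near ij
      ; (i≢j , inj₂ ji) → i≢j , Near-sym (Equivalence.to T-X⇔Near ji) })
    (λ (i≢j , l) → Equivalence.from (Adj⇔ {G = X n k} {a = i} {b = j}) (i≢j , inj₁ (Equivalence.from T-X⇔Near l)))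
    where
      Near-sym : ∀ {a b} → Near a b → Near b a
      Near-sym (inj₁ h) = inj₂ (inj₁ h)
      Near-sym (inj₂ (inj₁ h)) = inj₁ h
      Near-sym (inj₂ (inj₂ e)) = inj₂ (inj₂ (sym e))

  -- Out-of-range positions give a junk vertex; only positions below n are ever used.
  vertex : ℕ → Fin n
  vertex m with m ℕ.<? n
  ... | yes m<n = Fin.fromℕ< m<n
  ... | no _ = Fin.fromℕ< (ℕ.<-≤-trans (s≤s z≤n) k+1≤n)

  toℕ-vertex : ∀ {m} → m < n → toℕ (vertex m) ≡ m
  toℕ-vertex {m} m<n with m ℕ.<? n
  ... | yes _ = Fin.toℕ-fromℕ< _
  ... | no m≮n = ⊥-elim (m≮n m<n)

  record Full (β : ℕ) : Set where
    constructor full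
    field
      fits : 2 + suc β * K ≤ n

  blockList : ℕ → List (Fin n)
  blockList β = applyUpTo (λ t → vertex (2 + β * K + t)) K

  private
    [βK+t]/K≡β : ∀ β t → t < K → (β * K + t) / K ≡ β
    [βK+t]/K≡β β t t<K = trans (DivMod.+-distrib-/-∣ˡ {β * K} t (Div.n∣m*n β))
      (trans (cong₂ _+_ (DivMod.m*n/n≡m β K) (DivMod.m<n⇒m/n≡0 t<K)) (ℕ.+-identityʳ β))

    block-position< : ∀ {β t} → Full β → t < K → 2 + β * K + t < n
    block-position< {β} {t} (full fits) t<K = ℕ.<-≤-trans (ℕ.+-monoʳ-< (2 + β * K) t<K)
      (subst (_≤ n) (trans (cong (2 +_) (ℕ.+-comm K (β * K))) (sym (ℕ.+-assoc 2 (β * K) K))) fits)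

  ∈-blockList⁻ : ∀ {β c} → Full β → c ∈ blockList β → InBlock β c
  ∈-blockList⁻ {β} β-full c∈ with ∈-applyUpTo⁻ (λ t → vertex (2 + β * K + t)) c∈
  ... | t , t<K , refl = subst (2 ≤_) (sym position) (s≤s (s≤s z≤n)) ,
                         trans (cong (λ z → (z ∸ 2) / K) position) ([βK+t]/K≡β β t t<K)
    where position = toℕ-vertex (block-position< β-full t<K)

  ∈-blockList⁺ : ∀ {β c} → InBlock β c → c ∈ blockList β
  ∈-blockList⁺ {β} {c} (2≤c , refl) = subst (_∈ blockList β) vertex-c
    (∈-applyUpTo⁺ (λ t → vertex (2 + β * K + t)) (DivMod.m%n<n (toℕ c ∸ 2) K))
    where
      vertex-c : vertex (2 + β * K + (toℕ c ∸ 2) % K) ≡ c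
      vertex-c = Fin.toℕ-injective (trans (cong (toℕ ∘ vertex) position) (toℕ-vertex (Fin.toℕ<n c)))
        where
          position : 2 + β * K + (toℕ c ∸ 2) % K ≡ toℕ c
          position = begin
            2 + β * K + (toℕ c ∸ 2) % K    ≡⟨ cong (2 +_) (ℕ.+-comm (β * K) _) ⟩
            2 + ((toℕ c ∸ 2) % K + β * K)  ≡⟨ cong (2 +_) (DivMod.m≡m%n+[m/n]*n (toℕ c ∸ 2) K) ⟨
            2 + (toℕ c ∸ 2)                ≡⟨ ℕ.m+[n∸m]≡n 2≤c ⟩
            toℕ c                          ∎

  blockList-unique : ∀ {β} → Full β → Unique (blockList β)
  blockList-unique {β} β-full = Unique.applyUpTo⁺₁ _ K λ {i} {j} i<j j<K e → ℕ.<⇒≢ i<j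
    (ℕ.+-cancelˡ-≡ (2 + β * K) _ _ (trans (sym (toℕ-vertex (block-position< β-full (ℕ.<-trans i<j j<K))))
      (trans (cong toℕ e) (toℕ-vertex (block-position< β-full j<K)))))

  length-blockList : ∀ β → length (blockList β) ≡ K
  length-blockList β = List.length-applyUpTo (λ t → vertex (2 + β * K + t)) K

  Full-0 : Full 0
  Full-0 = full $ subst (λ m → 3 + m ≤ n) (sym (ℕ.+-identityʳ d)) (ℕ.≤-trans (ℕ.n≤1+n _) k+1≤n)

  Full-below : ∀ {β c} → 2 ≤ toℕ c → β < block c → Full β
  Full-below {β} {c} 2≤c β<c = full $ ℕ.<⇒≤ (ℕ.≤-<-trans
    (ℕ.≤-trans (ℕ.+-monoʳ-≤ 2 (ℕ.≤-trans (ℕ.*-monoˡ-≤ K β<c) (DivMod.m/n*n≤m (toℕ c ∸ 2) K)))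
               (ℕ.≤-reflexive (ℕ.m+[n∸m]≡n 2≤c)))
    (Fin.toℕ<n c))

  2≤k : 2 ≤ k
  2≤k = s≤s (s≤s z≤n)

  Hub⇒≢ : ∀ {i j} → Hub i → 2 ≤ toℕ j → i ≢ j
  Hub⇒≢ i<2 2≤j refl = ℕ.<⇒≱ i<2 2≤j

  block⇒≢ : ∀ {i j} → block i ≢ block j → i ≢ j
  block⇒≢ bi≢bj i≡j = bi≢bj (cong block i≡j)

  adj-from-hub : ∀ {i j} → Hub i → i ≢ j → Adj (X n k) i j
  adj-from-hub h i≢j = Equivalence.from Adj-X⇔ (i≢j , inj₁ h)

  adj-to-hub : ∀ {i j} → Hub j → i ≢ j → Adj (X n k) i j
  adj-to-hub h i≢j = Equivalence.from Adj-X⇔ (i≢j , inj₂ (inj₁ h))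

  zones⇒Near : ∀ {β i j} → Hub i ⊎ InBlock β i → Hub j ⊎ InBlock β j → Near i j
  zones⇒Near (inj₁ hub-i) _ = inj₁ hub-i
  zones⇒Near (inj₂ _) (inj₁ hub-j) = inj₂ (inj₁ hub-j)
  zones⇒Near (inj₂ (_ , i∈β)) (inj₂ (_ , j∈β)) = inj₂ (inj₂ (trans i∈β (sym j∈β)))

  complete-hubs∪block : ∀ {β C} → All (λ z → Hub z ⊎ InBlock β z) C → Complete (Adj (X n k)) C
  complete-hubs∪block all a∈ b∈ a≢b =
    Equivalence.from Adj-X⇔ (a≢b , zones⇒Near (All.lookup all a∈) (All.lookup all b∈))

  private
    vertex-< : ∀ m → m < 4 → toℕ (vertex m) ≡ m
    vertex-< m m<4 = toℕ-vertex (ℕ.<-≤-trans m<4 (ℕ.≤-trans (s≤s (s≤s (s≤s (s≤s z≤n)))) k+1≤n))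

  hub₀ hub₁ : Fin n
  hub₀ = vertex 0
  hub₁ = vertex 1

  Hub-hub₀ : Hub hub₀
  Hub-hub₀ = subst (_< 2) (sym (vertex-< 0 (s≤s z≤n))) (s≤s z≤n)

  Hub-hub₁ : Hub hub₁
  Hub-hub₁ = subst (_< 2) (sym (vertex-< 1 (s≤s (s≤s z≤n)))) (s≤s (s≤s z≤n))

  hub₀≢hub₁ : hub₀ ≢ hub₁
  hub₀≢hub₁ e = ℕ.0≢1+n (trans (sym (vertex-< 0 (s≤s z≤n))) (trans (cong toℕ e) (vertex-< 1 (s≤s (s≤s z≤n)))))

  other-hub : Fin n → Fin n
  other-hub i = vertex (1 ∸ toℕ i)

  private
    toℕ-other-hub : ∀ i → toℕ (other-hub i) ≡ 1 ∸ toℕ i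
    toℕ-other-hub i = vertex-< (1 ∸ toℕ i) (s≤s (ℕ.≤-trans (ℕ.m∸n≤m 1 (toℕ i)) (s≤s z≤n)))

  Hub-other-hub : ∀ i → Hub (other-hub i)
  Hub-other-hub i = subst (_< 2) (sym (toℕ-other-hub i)) (s≤s (ℕ.m∸n≤m 1 (toℕ i)))

  other-hub≢ : ∀ {i} → Hub i → i ≢ other-hub i
  other-hub≢ {i} i<2 e = m≢1∸m (toℕ i) i<2 (trans (cong toℕ e) (toℕ-other-hub i))
    where
      m≢1∸m : ∀ m → m < 2 → m ≢ 1 ∸ m
      m≢1∸m 0 _ ()
      m≢1∸m 1 _ ()
      m≢1∸m (suc (suc _)) (s≤s (s≤s ())) _

  far : Fin n
  far = vertex (2 + K)

  far-InBlock₁ : InBlock 1 far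
  far-InBlock₁ = subst (2 ≤_) (sym position) (s≤s (s≤s z≤n)) ,
                 trans (cong (λ m → (m ∸ 2) / K) position) (DivMod.n/n≡1 K)
    where
      position : toℕ far ≡ 2 + K
      position = toℕ-vertex (ℕ.<-≤-trans (ℕ.n<1+n _) k+1≤n)

  B₀ : List (Fin n)
  B₀ = blockList 0

  B₀-unique : Unique B₀
  B₀-unique = blockList-unique Full-0

  ∈B₀⁻ : ∀ {c} → c ∈ B₀ → InBlock 0 c
  ∈B₀⁻ = ∈-blockList⁻ Full-0

  length-B₀ : length B₀ ≡ K
  length-B₀ = length-blockList 0

  private
    far-outer : 2 ≤ toℕ far
    far-outer = proj₁ far-InBlock₁

    block₀⇒≢far : ∀ {z} → InBlock 0 z → far ≢ z
    block₀⇒≢far (_ , z∈B₀) = block⇒≢ λ e → ℕ.1+n≢0 (trans (sym (proj₂ far-InBlock₁)) (trans e z∈B₀))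

    Zone₀ : Fin n → Set
    Zone₀ z = Hub z ⊎ InBlock 0 z

    ¬Zone₀ : ∀ {z} → 2 ≤ toℕ z → block z ≢ 0 → ¬ Zone₀ z
    ¬Zone₀ 2≤z _ (inj₁ h) = ℕ.<⇒≱ h 2≤z
    ¬Zone₀ _ z∉B₀ (inj₂ (_ , e)) = z∉B₀ e

    B₀-zone : All Zone₀ B₀
    B₀-zone = All.tabulate (inj₂ ∘ ∈B₀⁻)

  cGt-hub-block₀ : ∀ {i j} → Hub i → InBlock 0 j → cGt (X n k) i j k
  cGt-hub-block₀ {i} {j} hub-i j∈B₀ =
    cGt-intro {G = X n k} 2≤k (far ∷ i' ∷ F) unique-path linked-path
      (adj-from-hub hub-i (Hub⇒≢ hub-i (proj₁ j∈B₀))) length-path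
    where
      i' = other-hub i
      B₀-j = remove _≟_ B₀-unique (∈-blockList⁺ j∈B₀)
      F = Removal.rest B₀-j
      Fj-block : All (InBlock 0) (F ++ j ∷ [])
      Fj-block = All.++⁺ (All.tabulate (∈B₀⁻ ∘ Removal.rest⊆ B₀-j)) (j∈B₀ ∷ [])
      Fj-outer : All (λ z → 2 ≤ toℕ z) (F ++ j ∷ [])
      Fj-outer = All.map proj₁ Fj-block
      i'j-unique : Unique (i' ∷ F ++ j ∷ [])
      i'j-unique = All.map (Hub⇒≢ (Hub-other-hub i)) Fj-outer
        ∷ rest-∷ʳ-unique B₀-j
      unique-path : Unique (i ∷ far ∷ i' ∷ F ++ j ∷ [])
      unique-path =
          (Hub⇒≢ hub-i far-outer ∷ other-hub≢ hub-i ∷ All.map (Hub⇒≢ hub-i) Fj-outer)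
        ∷ ((λ e → Hub⇒≢ (Hub-other-hub i) far-outer (sym e)) ∷ All.map block₀⇒≢far Fj-block)
        ∷ i'j-unique
      linked-path : Linked (Adj (X n k)) (i ∷ far ∷ i' ∷ F ++ j ∷ [])
      linked-path = adj-from-hub hub-i (Hub⇒≢ hub-i far-outer)
        ∷ adj-to-hub (Hub-other-hub i) (λ e → Hub⇒≢ (Hub-other-hub i) far-outer (sym e))
        ∷ complete⇒linked (complete-hubs∪block (inj₁ (Hub-other-hub i) ∷ All.map inj₂ Fj-block)) i'j-unique
      length-path : k < length (i ∷ far ∷ i' ∷ F ++ j ∷ [])
      length-path rewrite length-∷ʳ F {j} | Removal.length-rest B₀-j | length-B₀ = ℕ.≤-refl

  cGt-hub-outer : ∀ {i j} → Hub i → 2 ≤ toℕ j → block j ≢ 0 → cGt (X n k) i j k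
  cGt-hub-outer {i} {j} hub-i 2≤j j∉B₀ =
    cGt-intro {G = X n k} 2≤k (B₀ ++ i' ∷ []) unique-path linked-path (adj-from-hub hub-i (Hub⇒≢ hub-i 2≤j)) length-path
    where
      i' = other-hub i
      Z = i ∷ B₀ ++ i' ∷ []
      Z-zone : All Zone₀ Z
      Z-zone = inj₁ hub-i ∷ All.++⁺ B₀-zone (inj₁ (Hub-other-hub i) ∷ [])
      Z-unique : Unique Z
      Z-unique = All.++⁺ (All.tabulate (Hub⇒≢ hub-i ∘ proj₁ ∘ ∈B₀⁻)) (other-hub≢ hub-i ∷ [])
        ∷ unique-∷ʳ B₀-unique (λ i'∈B₀ → Hub⇒≢ (Hub-other-hub i) (proj₁ (∈B₀⁻ i'∈B₀)) refl)
      unique-path : Unique (Z ++ j ∷ [])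
      unique-path = unique-∷ʳ Z-unique (λ j∈Z → All.lookup (All-≢ (¬Zone₀ 2≤j j∉B₀) Z-zone) j∈Z refl)
      linked-path : Linked (Adj (X n k)) (Z ++ j ∷ [])
      linked-path = subst (Linked (Adj (X n k))) (sym (List.++-assoc (i ∷ B₀) (i' ∷ []) (j ∷ [])))
        (linked-join (i ∷ B₀) (complete⇒linked (complete-hubs∪block Z-zone) Z-unique)
          (adj-from-hub (Hub-other-hub i) (Hub⇒≢ (Hub-other-hub i) 2≤j) ∷ [-]))
      length-path : k < length (Z ++ j ∷ [])
      length-path rewrite length-∷ʳ Z {j} | length-∷ʳ B₀ {i'} | length-B₀ = ℕ.≤-refl

  cGt-block₀ : ∀ {i j} → InBlock 0 i → InBlock 0 j → i ≢ j → cGt (X n k) i j k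
  cGt-block₀ {i} {j} i∈B₀ j∈B₀ i≢j =
    cGt-intro {G = X n k} 2≤k (hub₀ ∷ far ∷ hub₁ ∷ F) unique-path linked-path
      (Equivalence.from Adj-X⇔ (i≢j , inj₂ (inj₂ (trans (proj₂ i∈B₀) (sym (proj₂ j∈B₀))))))
      length-path
    where
      B₀-i = remove _≟_ B₀-unique (∈-blockList⁺ i∈B₀)
      B₀-ij = remove _≟_ (AllPairs.tail (Removal.unique B₀-i))
                (Removal.⊆rest B₀-i (∈-blockList⁺ j∈B₀) (λ j≡i → i≢j (sym j≡i)))
      F = Removal.rest B₀-ij
      F⊆B₀ : ∀ {z} → z ∈ F → z ∈ B₀
      F⊆B₀ = Removal.rest⊆ B₀-i ∘ Removal.rest⊆ B₀-ij
      Fj-block : All (InBlock 0) (F ++ j ∷ [])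
      Fj-block = All.++⁺ (All.tabulate (∈B₀⁻ ∘ F⊆B₀)) (j∈B₀ ∷ [])
      Fj-outer : All (λ z → 2 ≤ toℕ z) (F ++ j ∷ [])
      Fj-outer = All.map proj₁ Fj-block
      hub₁Fj-unique : Unique (hub₁ ∷ F ++ j ∷ [])
      hub₁Fj-unique = All.map (Hub⇒≢ Hub-hub₁) Fj-outer
        ∷ rest-∷ʳ-unique B₀-ij
      i∉Fj : All (i ≢_) (F ++ j ∷ [])
      i∉Fj = All.++⁺ (All.tabulate (∉-rest B₀-i ∘ Removal.rest⊆ B₀-ij)) (i≢j ∷ [])
      unique-path : Unique (i ∷ hub₀ ∷ far ∷ hub₁ ∷ F ++ j ∷ [])
      unique-path =
          ((λ e → Hub⇒≢ Hub-hub₀ (proj₁ i∈B₀) (sym e)) ∷ (λ e → block₀⇒≢far i∈B₀ (sym e))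
            ∷ (λ e → Hub⇒≢ Hub-hub₁ (proj₁ i∈B₀) (sym e)) ∷ i∉Fj)
        ∷ (Hub⇒≢ Hub-hub₀ far-outer ∷ hub₀≢hub₁ ∷ All.map (Hub⇒≢ Hub-hub₀) Fj-outer)
        ∷ ((λ e → Hub⇒≢ Hub-hub₁ far-outer (sym e)) ∷ All.map block₀⇒≢far Fj-block)
        ∷ hub₁Fj-unique
      linked-path : Linked (Adj (X n k)) (i ∷ hub₀ ∷ far ∷ hub₁ ∷ F ++ j ∷ [])
      linked-path = adj-to-hub Hub-hub₀ (λ e → Hub⇒≢ Hub-hub₀ (proj₁ i∈B₀) (sym e))
        ∷ adj-from-hub Hub-hub₀ (Hub⇒≢ Hub-hub₀ far-outer)
        ∷ adj-to-hub Hub-hub₁ (λ e → Hub⇒≢ Hub-hub₁ far-outer (sym e))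
        ∷ complete⇒linked (complete-hubs∪block (inj₁ Hub-hub₁ ∷ All.map inj₂ Fj-block)) hub₁Fj-unique
      length-path : k < length (i ∷ hub₀ ∷ far ∷ hub₁ ∷ F ++ j ∷ [])
      length-path rewrite length-∷ʳ F {j} | Removal.length-rest B₀-ij | Removal.length-rest B₀-i | length-B₀ = ℕ.≤-refl

  cGt-outer : ∀ {i j} → 2 ≤ toℕ i → 2 ≤ toℕ j → i ≢ j → block i ≡ block j → block i ≢ 0 → cGt (X n k) i j k
  cGt-outer {i} {j} 2≤i 2≤j i≢j same-block i∉B₀ =
    cGt-intro {G = X n k} 2≤k Z unique-path linked-path
      (Equivalence.from Adj-X⇔ (i≢j , inj₂ (inj₂ same-block)))
      length-path
    where
      Z = hub₀ ∷ B₀ ++ hub₁ ∷ []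
      Z-zone : All Zone₀ Z
      Z-zone = inj₁ Hub-hub₀ ∷ All.++⁺ B₀-zone (inj₁ Hub-hub₁ ∷ [])
      Z-unique : Unique Z
      Z-unique = All.++⁺ (All.tabulate (Hub⇒≢ Hub-hub₀ ∘ proj₁ ∘ ∈B₀⁻)) (hub₀≢hub₁ ∷ [])
        ∷ unique-∷ʳ B₀-unique (λ hub₁∈B₀ → Hub⇒≢ Hub-hub₁ (proj₁ (∈B₀⁻ hub₁∈B₀)) refl)
      unique-path : Unique (i ∷ Z ++ j ∷ [])
      unique-path = All.++⁺ (All-≢ (¬Zone₀ 2≤i i∉B₀) Z-zone) (i≢j ∷ [])
        ∷ unique-∷ʳ Z-unique
            (λ j∈Z → All.lookup (All-≢ (¬Zone₀ 2≤j (λ e → i∉B₀ (trans same-block e))) Z-zone) j∈Z refl)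
      linked-path : Linked (Adj (X n k)) (i ∷ Z ++ j ∷ [])
      linked-path = adj-to-hub Hub-hub₀ (λ e → Hub⇒≢ Hub-hub₀ 2≤i (sym e))
        ∷ subst (Linked (Adj (X n k))) (sym (List.++-assoc (hub₀ ∷ B₀) (hub₁ ∷ []) (j ∷ [])))
            (linked-join (hub₀ ∷ B₀) (complete⇒linked (complete-hubs∪block Z-zone) Z-unique)
              (adj-from-hub Hub-hub₁ (Hub⇒≢ Hub-hub₁ 2≤j) ∷ [-]))
      length-path : k < length (i ∷ Z ++ j ∷ [])
      length-path rewrite length-∷ʳ Z {j} | length-∷ʳ B₀ {hub₁} | length-B₀ = ℕ.n≤1+n _

  Near-outer⇒same-block : ∀ {i j} → 2 ≤ toℕ i → 2 ≤ toℕ j → Near i j → block i ≡ block j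
  Near-outer⇒same-block 2≤i _ (inj₁ i<2) = ⊥-elim (ℕ.<⇒≱ i<2 2≤i)
  Near-outer⇒same-block _ 2≤j (inj₂ (inj₁ j<2)) = ⊥-elim (ℕ.<⇒≱ j<2 2≤j)
  Near-outer⇒same-block _ _ (inj₂ (inj₂ same-block)) = same-block

  cGt-X : ∀ {i j} → Adj (X n k) i j → 2 ≤ toℕ j → cGt (X n k) i j k
  cGt-X {i} {j} ij 2≤j with Equivalence.to Adj-X⇔ ij | toℕ i ℕ.<? 2 | block j ℕ.≟ 0
  ... | _ | yes hub-i | yes j∈B₀ = cGt-hub-block₀ hub-i (2≤j , j∈B₀)
  ... | _ | yes hub-i | no j∉B₀ = cGt-hub-outer hub-i 2≤j j∉B₀
  ... | i≢j , near | no i≮2 | yes j∈B₀ =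
    cGt-block₀ (ℕ.≮⇒≥ i≮2 , trans (Near-outer⇒same-block (ℕ.≮⇒≥ i≮2) 2≤j near) j∈B₀) (2≤j , j∈B₀) i≢j
  ... | i≢j , near | no i≮2 | no j∉B₀ =
    cGt-outer (ℕ.≮⇒≥ i≮2) 2≤j i≢j same-block (j∉B₀ ∘ trans (sym same-block))
    where same-block = Near-outer⇒same-block (ℕ.≮⇒≥ i≮2) 2≤j near

  another-block : ∀ β → ∃ λ t → 2 ≤ toℕ t × block t ≢ β
  another-block zero = far , far-outer , λ e → ℕ.1+n≢0 (trans (sym (proj₂ far-InBlock₁)) e)
  another-block (suc β) = vertex 2 , subst (2 ≤_) (sym position) ℕ.≤-refl ,
    λ e → ℕ.0≢1+n (trans (sym (cong (λ m → (m ∸ 2) / K) position)) e)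
    where
      position : toℕ (vertex 2) ≡ 2
      position = vertex-< 2 (s≤s (s≤s (s≤s z≤n)))

  Full-either : ∀ {i j} → 2 ≤ toℕ i → 2 ≤ toℕ j → block i ≢ block j → Full (block i) ⊎ Full (block j)
  Full-either {i} {j} 2≤i 2≤j i≢j with ℕ.<-cmp (block i) (block j)
  ... | tri< i<j _ _ = inj₁ (Full-below 2≤j i<j)
  ... | tri≈ _ e _ = ⊥-elim (i≢j e)
  ... | tri> _ _ j<i = inj₂ (Full-below 2≤i j<i)

module Switching
  (d n : ℕ) (k+1≤n : 4 + d ≤ n) (s : ℕ) (3≤s : 3 ≤ s) (s≤k : s ≤ 3 + d)
  (G : Graph n) (G-2-connected : TwoConnected G) (N-G≡g : N s G ≡ g s n (3 + d))
  (u v x : Fin n) (u~v : Adj G u v) (u~x : Adj G u x) (v≢x : v ≢ x)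
  (c-uv≤k : cLe G u v (3 + d)) (N-switch≡N : N s (switch G x u) ≡ N s G)
  (M : Graph n) (M-maximal : EdgeMaximal (3 + d) (switch G x u) u v M) (M≅X : M ≅ X n (3 + d))
  where

  open ExtremalGraph d n k+1≤n

  G' : Graph n
  G' = switch G x u

  x≢u : x ≢ u
  x≢u x≡u = adj-irrefl {G = G} u~x (sym x≡u)

  u≢v : u ≢ v
  u≢v = adj-irrefl {G = G} u~v

  G'⊆M : G' ⊆G M
  G'⊆M = proj₁ M-maximal

  N-G'≡N-M : N s G' ≡ N s M
  N-G'≡N-M = trans N-switch≡N (trans N-G≡g (sym (≅-preserves-N {G = M} {H = X n (3 + d)} M≅X s)))

  private
    to from : Fin n → Fin n
    to = Inverse.to (proj₁ M≅X)
    from = Inverse.from (proj₁ M≅X)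

    from∘to : ∀ a → from (to a) ≡ a
    from∘to = Inverse.strictlyInverseʳ (proj₁ M≅X)

  Adj-M⇔ : ∀ {a b} → Adj M a b ⇔ (a ≢ b × Near (to a) (to b))
  Adj-M⇔ {a} {b} = mk⇔
    (λ ab → adj-irrefl {G = M} ab , proj₂ (Equivalence.to Adj-X⇔ (proj₁ (proj₂ M≅X a b) ab)))
    (λ (a≢b , l) → proj₂ (proj₂ M≅X a b) (Equivalence.from Adj-X⇔
      ((λ e → a≢b (trans (sym (from∘to a)) (trans (cong from e) (from∘to b)))) , l)))

  c-uv≤k-M : cLe M u v (3 + d)
  c-uv≤k-M = proj₁ (proj₂ M-maximal)

  M-uv : Adj M u v
  M-uv = G'⊆M u v (Adj-switch-u G x≢u u~v)

  uv-hubs : Hub (to u) × Hub (to v)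
  uv-hubs with toℕ (to u) ℕ.<? 2 | toℕ (to v) ℕ.<? 2
  ... | yes hub-u | yes hub-v = hub-u , hub-v
  ... | _ | no v≮2 = ⊥-elim (cLe⇒¬cGt {G = M} c-uv≤k-M
    (≅-reflects-cGt {G = M} {H = X n (3 + d)} M≅X (cGt-X (proj₁ (proj₂ M≅X u v) M-uv) (ℕ.≮⇒≥ v≮2))))
  ... | no u≮2 | yes _ = ⊥-elim (cLe⇒¬cGt {G = M} (cLe-sym {G = M} c-uv≤k-M)
    (≅-reflects-cGt {G = M} {H = X n (3 + d)} M≅X
      (cGt-X (proj₁ (proj₂ M≅X v u) (adj-sym {G = M} M-uv)) (ℕ.≮⇒≥ u≮2))))

  outer : ∀ {a} → a ≢ u → a ≢ v → 2 ≤ toℕ (to a)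
  outer {a} a≢u a≢v with toℕ (to a) ℕ.<? 2
  ... | no a≮2 = ℕ.≮⇒≥ a≮2
  ... | yes a<2 = ⊥-elim (pigeonhole (toℕ (to a)) (toℕ (to u)) (toℕ (to v)) a<2 (proj₁ uv-hubs) (proj₂ uv-hubs)
    (a≢u ∘ to-injective) (a≢v ∘ to-injective) (u≢v ∘ to-injective))
    where
      to-injective : ∀ {b c} → toℕ (to b) ≡ toℕ (to c) → b ≡ c
      to-injective {b} {c} e = trans (sym (from∘to b)) (trans (cong from (Fin.toℕ-injective e)) (from∘to c))
      pigeonhole : ∀ l m r → l < 2 → m < 2 → r < 2 → l ≢ m → l ≢ r → m ≢ r → ⊥
      pigeonhole 0 0 _ _ _ _ l≢m _ _ = l≢m refl
      pigeonhole 1 1 _ _ _ _ l≢m _ _ = l≢m refl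
      pigeonhole 0 1 0 _ _ _ _ l≢r _ = l≢r refl
      pigeonhole 1 0 1 _ _ _ _ l≢r _ = l≢r refl
      pigeonhole 0 1 1 _ _ _ _ _ m≢r = m≢r refl
      pigeonhole 1 0 0 _ _ _ _ _ m≢r = m≢r refl
      pigeonhole (suc (suc _)) _ _ (s≤s (s≤s ())) _ _ _ _ _
      pigeonhole _ (suc (suc _)) _ _ (s≤s (s≤s ())) _ _ _ _
      pigeonhole _ _ (suc (suc _)) _ _ (s≤s (s≤s ())) _ _ _

  blockM : Fin n → ℕ
  blockM a = block (to a)

  Block : ℕ → List (Fin n)
  Block β = map from (blockList β)

  ∈Block⁻ : ∀ {β c} → Full β → c ∈ Block β → InBlock β (to c)
  ∈Block⁻ {β} β-full c∈ with ∈-map⁻ from c∈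
  ... | t , t∈ , refl = subst (InBlock β) (sym (Inverse.strictlyInverseˡ (proj₁ M≅X) t)) (∈-blockList⁻ β-full t∈)

  ∈Block⁺ : ∀ {β c} → InBlock β (to c) → c ∈ Block β
  ∈Block⁺ {β} {c} c∈β = subst (_∈ Block β) (from∘to c) (∈-map⁺ from (∈-blockList⁺ c∈β))

  Block-unique : ∀ {β} → Full β → Unique (Block β)
  Block-unique {β} β-full = Unique.map⁺ (λ {a} {b} e → trans (sym (to∘from a)) (trans (cong to e) (to∘from b)))
    (blockList-unique β-full)
    where to∘from = Inverse.strictlyInverseˡ (proj₁ M≅X)

  length-Block : ∀ β → length (Block β) ≡ K
  length-Block β = trans (List.length-map from (blockList β)) (length-blockList β)

  outer⇒≢u : ∀ {z} → 2 ≤ toℕ (to z) → z ≢ u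
  outer⇒≢u 2≤z refl = ℕ.<⇒≱ (proj₁ uv-hubs) 2≤z

  outer⇒≢v : ∀ {z} → 2 ≤ toℕ (to z) → z ≢ v
  outer⇒≢v 2≤z refl = ℕ.<⇒≱ (proj₂ uv-hubs) 2≤z

  hubs∪Block-unique : ∀ {β} → Full β → Unique (u ∷ v ∷ Block β)
  hubs∪Block-unique {β} β-full = (u≢v ∷ All.tabulate (λ z∈ e → outer⇒≢u (proj₁ (∈Block⁻ β-full z∈)) (sym e)))
    ∷ All.tabulate (λ z∈ e → outer⇒≢v (proj₁ (∈Block⁻ β-full z∈)) (sym e))
    ∷ Block-unique β-full

  -- Hubs ∪ block β is a k-clique of M, and every s-clique of M is one of G'.
  forced-complete : ∀ {β} → Full β → Complete (Adj G') (u ∷ v ∷ Block β)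
  forced-complete {β} β-full =
    ⊆-N≡⇒Complete s {H = G'} {M = M} G'⊆M N-G'≡N-M (ℕ.≤-trans (s≤s (s≤s z≤n)) 3≤s) (hubs∪Block-unique β-full)
    (subst (s ≤_) (sym (cong (2 +_) (length-Block β))) s≤k)
    (λ a∈ b∈ a≢b → Equivalence.from Adj-M⇔ (a≢b , zones⇒Near (zone a∈) (zone b∈)))
    where
      zone : ∀ {z} → z ∈ u ∷ v ∷ Block β → Hub (to z) ⊎ InBlock β (to z)
      zone (here refl) = inj₁ (proj₁ uv-hubs)
      zone (there (here refl)) = inj₁ (proj₂ uv-hubs)
      zone (there (there z∈)) = inj₂ (∈Block⁻ β-full z∈)

  G'-same-block : ∀ {a b} → Adj G' a b → a ≢ u → a ≢ v → b ≢ u → b ≢ v → blockM a ≡ blockM b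
  G'-same-block {a} {b} ab a≢u a≢v b≢u b≢v =
    Near-outer⇒same-block (outer a≢u a≢v) (outer b≢u b≢v) (proj₂ (Equivalence.to Adj-M⇔ (G'⊆M a b ab)))

  x-outer : 2 ≤ toℕ (to x)
  x-outer = outer x≢u (λ x≡v → v≢x (sym x≡v))

  -- An edge of G − {u,v} between two blocks is not in G' ⊆ M, so the switch removed it: it is at x.
  crossing-neighbour : ConnectedMinus G (λ z → z ≡ u ⊎ z ≡ v) →
    ∃ λ w → Adj G x w × w ≢ u × w ≢ v × blockM w ≢ blockM x
  crossing-neighbour connected with another-block (blockM x)
  ... | t , 2≤t , t∉x-block = crossing (walk-crosses blockM x∉uv (connected x t' x∉uv t'∉uv) x≢t'-block)
    where
      t' = from t
      to-t' : to t' ≡ t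
      to-t' = Inverse.strictlyInverseˡ (proj₁ M≅X) t
      2≤t' : 2 ≤ toℕ (to t')
      2≤t' = subst (λ z → 2 ≤ toℕ z) (sym to-t') 2≤t
      ∉uv : ∀ {z} → z ≢ u → z ≢ v → ¬ (z ≡ u ⊎ z ≡ v)
      ∉uv z≢u _ (inj₁ z≡u) = z≢u z≡u
      ∉uv _ z≢v (inj₂ z≡v) = z≢v z≡v
      x∉uv = ∉uv x≢u (λ x≡v → v≢x (sym x≡v))
      t'∉uv = ∉uv (outer⇒≢u 2≤t') (outer⇒≢v 2≤t')
      x≢t'-block : blockM x ≢ blockM t'
      x≢t'-block e = t∉x-block (trans (cong block (sym to-t')) (sym e))
      crossing : (∃ λ a → ∃ λ b → ¬ (a ≡ u ⊎ a ≡ v) × ¬ (b ≡ u ⊎ b ≡ v) × Adj G a b × blockM a ≢ blockM b) →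
        ∃ λ w → Adj G x w × w ≢ u × w ≢ v × blockM w ≢ blockM x
      crossing (a , b , a∉uv , b∉uv , ab , a≢b-block) with a ≟ x | b ≟ x
      ... | yes refl | _ = b , ab , b∉uv ∘ inj₁ , b∉uv ∘ inj₂ , a≢b-block ∘ sym
      ... | no _ | yes refl = a , adj-sym {G = G} ab , a∉uv ∘ inj₁ , a∉uv ∘ inj₂ , a≢b-block
      ... | no a≢x | no b≢x = ⊥-elim (a≢b-block (G'-same-block
        (Equivalence.from (Adj-switch-away G x≢u a≢x (a∉uv ∘ inj₁) b≢x (b∉uv ∘ inj₁)) ab)
        (a∉uv ∘ inj₁) (a∉uv ∘ inj₂) (b∉uv ∘ inj₁) (b∉uv ∘ inj₂)))

  complete-v∪Block : ∀ {β} → Full β → Complete (Adj G) (v ∷ Block β)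
  complete-v∪Block {β} β-full a∈ b∈ a≢b =
    Adj-switch⇒Adj G x≢u (≢u a∈) (≢u b∈) (forced-complete β-full (there a∈) (there b∈) a≢b)
    where
      ≢u : ∀ {z} → z ∈ v ∷ Block β → z ≢ u
      ≢u (here refl) = u≢v ∘ sym
      ≢u (there z∈) = outer⇒≢u (proj₁ (∈Block⁻ β-full z∈))

  -- The cycle u x w (block of w minus w) v.
  neighbour-block-full⇒⊥ : ∀ {w} → Adj G x w → w ≢ u → w ≢ v → blockM w ≢ blockM x → Full (blockM w) → ⊥
  neighbour-block-full⇒⊥ {w} x~w w≢u w≢v w≢x-block β-full =
    cLe⇒¬cGt {G = G} c-uv≤k (cGt-intro {G = G} 2≤k (x ∷ w ∷ W) unique-path linked-path u~v length-path)
    where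
      β = blockM w
      w∈β : InBlock β (to w)
      w∈β = outer w≢u w≢v , refl
      Block-w = remove _≟_ (Block-unique β-full) (∈Block⁺ w∈β)
      W = Removal.rest Block-w
      wW-block : All (λ z → InBlock β (to z)) (w ∷ W)
      wW-block = w∈β ∷ All.tabulate (∈Block⁻ β-full ∘ Removal.rest⊆ Block-w)
      wWv-unique : Unique (w ∷ W ++ v ∷ [])
      wWv-unique = unique-∷ʳ (Removal.unique Block-w) (λ v∈ → outer⇒≢v (proj₁ (All.lookup wW-block v∈)) refl)
      wWv⊆ : ∀ {z} → z ∈ w ∷ W ++ v ∷ [] → z ∈ v ∷ Block β
      wWv⊆ (here refl) = there (∈Block⁺ w∈β)
      wWv⊆ (there z∈) with ∈-++⁻ W z∈
      ... | inj₁ z∈W = there (Removal.rest⊆ Block-w z∈W)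
      ... | inj₂ (here refl) = here refl
      unique-path : Unique (u ∷ x ∷ w ∷ W ++ v ∷ [])
      unique-path =
          ((λ u≡x → x≢u (sym u≡x))
            ∷ All.++⁺ (All.map (λ z∈β u≡z → outer⇒≢u (proj₁ z∈β) (sym u≡z)) wW-block) (u≢v ∷ []))
        ∷ All.++⁺ (All.map (λ z∈β x≡z → w≢x-block (trans (sym (proj₂ z∈β)) (cong blockM (sym x≡z)))) wW-block)
            ((λ x≡v → v≢x (sym x≡v)) ∷ [])
        ∷ wWv-unique
      linked-path : Linked (Adj G) (u ∷ x ∷ w ∷ W ++ v ∷ [])
      linked-path = u~x ∷ x~w ∷ complete⇒linked (complete-⊆ (complete-v∪Block β-full) wWv⊆) wWv-unique
      length-path : k < length (u ∷ x ∷ w ∷ W ++ v ∷ [])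
      length-path rewrite length-∷ʳ W {v} | Removal.length-rest Block-w | length-Block β = ℕ.≤-refl

  private
    x∈Block : x ∈ Block (blockM x)
    x∈Block = ∈Block⁺ (x-outer , refl)

    u~x-Block : Full (blockM x) → ∀ {b} → b ∈ u ∷ v ∷ Block (blockM x) → u ≢ b → Adj G u b
    u~x-Block _ (here refl) u≢u = ⊥-elim (u≢u refl)
    u~x-Block _ (there (here refl)) _ = u~v
    u~x-Block β-full {b} (there (there b∈)) u≢b with b ≟ x
    ... | yes refl = u~x
    ... | no b≢x = proj₂ (Equivalence.to (Adj-switch-x G x≢u b≢x (u≢b ∘ sym))
      (forced-complete β-full (there (there x∈Block)) (there (there b∈)) (b≢x ∘ sym)))

  complete-hubs∪x-Block : Full (blockM x) → Complete (Adj G) (u ∷ v ∷ Block (blockM x))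
  complete-hubs∪x-Block β-full {a} {b} a∈ b∈ a≢b with a ≟ u | b ≟ u
  ... | yes refl | _ = u~x-Block β-full b∈ a≢b
  ... | no _ | yes refl = adj-sym {G = G} (u~x-Block β-full a∈ (a≢b ∘ sym))
  ... | no a≢u | no b≢u = Adj-switch⇒Adj G x≢u a≢u b≢u (forced-complete β-full a∈ b∈ a≢b)

  Avoids-x,u,v : Fin n → Set
  Avoids-x,u,v z = ¬ z ≡ x × ¬ (z ≡ u ⊎ z ≡ v)

  path-stays-in-block : ∀ {w π} → All Avoids-x,u,v (w ∷ π) → Linked (Adj G) (w ∷ π) →
    All (λ z → blockM z ≡ blockM w) (w ∷ π)
  path-stays-in-block avoids linked = linked-propagate
    (λ (a≢x , a∉uv) (b≢x , b∉uv) ab a∈w → trans (sym (G'-same-block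
      (Equivalence.from (Adj-switch-away G x≢u a≢x (a∉uv ∘ inj₁) b≢x (b∉uv ∘ inj₁)) ab)
      (a∉uv ∘ inj₁) (a∉uv ∘ inj₂) (b∉uv ∘ inj₁) (b∉uv ∘ inj₂))) a∈w)
    avoids linked refl

  HubPair : Fin n → Fin n → Set
  HubPair q p = (q ≡ u × p ≡ v) ⊎ (q ≡ v × p ≡ u)

  -- The cycle q (block of x minus x) x w π p, where {q,p} = {u,v}.
  cGt-through-x-Block : ∀ {q p w π} → HubPair q p → Full (blockM x) → Adj G x w → blockM w ≢ blockM x →
    Unique (w ∷ π) → All Avoids-x,u,v (w ∷ π) → Linked (Adj G) (w ∷ π ++ p ∷ []) → cGt G q p k
  cGt-through-x-Block {q} {p} {w} {π} qp β-full x~w w∉x-block wπ-unique wπ-avoids wπp-linked =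
    cGt-intro {G = G} 2≤k Y unique-path linked-path (hub-pair-adjacent qp) length-path
    where
      x-Block = remove _≟_ (Block-unique β-full) x∈Block
      X' = Removal.rest x-Block
      Y = X' ++ x ∷ w ∷ π
      Away : Fin n → Set
      Away z = z ≢ u × z ≢ v
      hub-pair-adjacent : HubPair q p → Adj G q p
      hub-pair-adjacent (inj₁ (refl , refl)) = u~v
      hub-pair-adjacent (inj₂ (refl , refl)) = adj-sym {G = G} u~v
      q-hub : q ≡ u ⊎ q ≡ v
      q-hub = Sum.map proj₁ proj₁ qp
      p-hub : p ≡ u ⊎ p ≡ v
      p-hub = [ inj₂ ∘ proj₂ , inj₁ ∘ proj₂ ] qp
      q≢p : HubPair q p → q ≢ p
      q≢p (inj₁ (refl , refl)) = u≢v
      q≢p (inj₂ (refl , refl)) = u≢v ∘ sym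
      hub∉ : ∀ {h} → h ≡ u ⊎ h ≡ v → ∀ {zs} → All Away zs → All (h ≢_) zs
      hub∉ (inj₁ refl) = All.map λ (z≢u , _) → z≢u ∘ sym
      hub∉ (inj₂ refl) = All.map λ (_ , z≢v) → z≢v ∘ sym
      X'-block : All (λ z → InBlock (blockM x) (to z)) X'
      X'-block = All.tabulate (∈Block⁻ β-full ∘ Removal.rest⊆ x-Block)
      X'-away : All Away X'
      X'-away = All.map (λ (2≤z , _) → outer⇒≢u 2≤z , outer⇒≢v 2≤z) X'-block
      x-away : Away x
      x-away = x≢u , λ x≡v → v≢x (sym x≡v)
      Y-away : All Away Y
      Y-away = All.++⁺ X'-away (x-away ∷ All.map (λ (_ , z∉uv) → z∉uv ∘ inj₁ , z∉uv ∘ inj₂) wπ-avoids)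
      wπ-block : All (λ z → blockM z ≡ blockM w) (w ∷ π)
      wπ-block = path-stays-in-block wπ-avoids (linked-++⁻ˡ (w ∷ π) wπp-linked)
      X'∩xwπ : ∀ {z} → z ∈ X' × z ∈ x ∷ w ∷ π → ⊥
      X'∩xwπ (z∈X' , here refl) = ∉-rest x-Block z∈X' refl
      X'∩xwπ (z∈X' , there z∈wπ) =
        w∉x-block (trans (sym (All.lookup wπ-block z∈wπ)) (proj₂ (All.lookup X'-block z∈X')))
      Y-unique : Unique Y
      Y-unique = Unique.++⁺ (AllPairs.tail (Removal.unique x-Block))
        (All.map (λ (z≢x , _) → z≢x ∘ sym) wπ-avoids ∷ wπ-unique) X'∩xwπ
      unique-path : Unique (q ∷ Y ++ p ∷ [])
      unique-path = unique-∷ʳ (hub∉ q-hub Y-away ∷ Y-unique) λ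
        { (here p≡q) → q≢p qp (sym p≡q)
        ; (there p∈Y) → All.lookup (hub∉ p-hub Y-away) p∈Y refl }
      linked-path : Linked (Adj G) (q ∷ Y ++ p ∷ [])
      linked-path = subst (Linked (Adj G)) (sym (cong (q ∷_) (List.++-assoc X' (x ∷ w ∷ π) (p ∷ []))))
        (linked-join (q ∷ X')
          (complete⇒linked (complete-⊆ (complete-hubs∪x-Block β-full) qX'x⊆)
            (hub∉ q-hub (All.++⁺ X'-away (x-away ∷ [])) ∷ rest-∷ʳ-unique x-Block))
          (x~w ∷ wπp-linked))
        where
          qX'x⊆ : ∀ {z} → z ∈ q ∷ X' ++ x ∷ [] → z ∈ u ∷ v ∷ Block (blockM x)
          qX'x⊆ (here refl) = [ (λ { refl → here refl }) , (λ { refl → there (here refl) }) ] q-hub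
          qX'x⊆ (there z∈) with ∈-++⁻ X' z∈
          ... | inj₁ z∈X' = there (there (Removal.rest⊆ x-Block z∈X'))
          ... | inj₂ (here refl) = there (there x∈Block)
      length-path : k < length (q ∷ Y ++ p ∷ [])
      length-path rewrite length-∷ʳ Y {p} | List.length-++ X' {x ∷ w ∷ π}
                        | ℕ.suc-injective (trans (Removal.length-rest x-Block) (length-Block (blockM x))) =
        s≤s (s≤s (subst (_≤ d + (2 + length π)) (ℕ.+-comm d 2) (ℕ.+-monoʳ-≤ d (ℕ.m≤m+n 2 (length π)))))

  own-block-full⇒⊥ : ∀ {w} → Adj G x w → w ≢ u → w ≢ v → blockM w ≢ blockM x → Full (blockM x) → ⊥
  own-block-full⇒⊥ {w} x~w w≢u w≢v w∉x-block β-full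
    with walk⇒path-to {G = G} {D = _≡ x} {P = λ z → z ≡ u ⊎ z ≡ v} (λ z → (z ≟ u) ⊎-dec (z ≟ v))
           (λ { (inj₁ w≡u) → w≢u w≡u ; (inj₂ w≡v) → w≢v w≡v }) w≢x (inj₁ refl)
           (proj₂ (proj₂ G-2-connected) x w u w≢x (x≢u ∘ sym))
    where
      w≢x : w ≢ x
      w≢x w≡x = w∉x-block (cong blockM w≡x)
  ... | π , p , inj₁ refl , wπ-unique , wπ-avoids , wπp-linked = cLe⇒¬cGt {G = G} (cLe-sym {G = G} c-uv≤k)
    (cGt-through-x-Block (inj₂ (refl , refl)) β-full x~w w∉x-block wπ-unique wπ-avoids wπp-linked)
  ... | π , p , inj₂ refl , wπ-unique , wπ-avoids , wπp-linked = cLe⇒¬cGt {G = G} c-uv≤k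
    (cGt-through-x-Block (inj₁ (refl , refl)) β-full x~w w∉x-block wπ-unique wπ-avoids wπp-linked)

  vertex-cut : IsVertexCut2 G u v
  vertex-cut connected with crossing-neighbour connected
  ... | w , x~w , w≢u , w≢v , w∉x-block with Full-either (outer w≢u w≢v) x-outer w∉x-block
  ...   | inj₁ w-full = neighbour-block-full⇒⊥ x~w w≢u w≢v w∉x-block w-full
  ...   | inj₂ x-full = own-block-full⇒⊥ x~w w≢u w≢v w∉x-block x-full

lemma10 : (k s n : ℕ) → 3 ≤ s → s ≤ k → suc k ≤ n →
    (G : Graph n) → TwoConnected G → N s G ≡ g s n k →
    (u v x : Fin n) → Adj G u v → Adj G u x → v ≢ x →
    cLe G u v k →
    (∃ λ w → Adj G u w × Adj G x w) →
    N s (switch G x u) ≡ N s G →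
    (M : Graph n) → EdgeMaximal k (switch G x u) u v M → M ≅ X n k →
    IsVertexCut2 G u v
lemma10 (suc (suc (suc d))) s n 3≤s s≤k k+1≤n G 2-connected N≡g u v x u~v u~x v≢x c-uv≤k _ N-switch≡N M maximal M≅X =
  Switching.vertex-cut d n k+1≤n s 3≤s s≤k G 2-connected N≡g u v x u~v u~x v≢x c-uv≤k N-switch≡N M maximal M≅X
lemma10 0 _ _ (s≤s _) ()
lemma10 1 _ _ (s≤s (s≤s _)) (s≤s ())
lemma10 2 _ _ (s≤s (s≤s (s≤s _))) (s≤s (s≤s ()))
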